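{- Let $(\alpha_k)_{k\ge1},(\beta_k)_{k\ge1},(\gamma_k)_{k\ge1}$ be weight sequences with $\alpha(x)=\sum_{k\ge1}\alpha_kx^k$, $\beta(x)=\sum_{k\ge1}\beta_kx^k$, $\gamma(x)=\sum_{k\ge1}\gamma_kx^k$, and let $V_n$ be the total weight of the set $\mathcal{V}_n$ of weighted Dyck paths of length $2n$ described in the context. Then, as formal power series, $$\sum_{n\ge0}V_nx^n=\frac{1}{1-\gamma(x)-\frac{\alpha(x)^2\beta(x)}{1-\alpha(x)}}.$$
   Context: A Dyck path of length $2n$ is a lattice path from $(0,0)$ to $(2n,0)$ with steps $\mathbf{u}=(1,1)$ and $\mathbf{d}=(1,-1)$ that never goes below the $x$-axis. A valley is an occurrence of $\mathbf{du}$; its level is the ordinate of the common point of its two steps. A pyramid is a consecutive section $\mathbf{u}^h\mathbf{d}^h$ ($h\ge1$ is its height); it is maximal if it cannot be extended to a section $\mathbf{u}^{h+1}\mathbf{d}^{h+1}$; its altitude is the ordinate of the endpoint of its last $\mathbf{d}$-step. A Dyck path is primitive if it is nonempty and touches the $x$-axis only at its two endpoints. Let $\mathcal{A}_n$ be the set of primitive Dyck paths $P$ of length $2n$ all of whose valleys (if any) lie at the same level, each carrying a weight $w(P)$ defined as follows: if $P$ has no valley, then $P=\mathbf{u}^n\mathbf{d}^n$ is a maximal pyramid of height $n$ at altitude $0$ and $w(P)=\gamma_n$; otherwise all valleys are at a common level $k\ge1$ and $P=\mathbf{u}^k\,\mathbf{u}^{i_1}\mathbf{d}^{i_1}\cdots\mathbf{u}^{i_r}\mathbf{d}^{i_r}\,\mathbf{d}^k$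 with $r\ge2$, $i_1,\dots,i_r\ge1$ (the $\mathbf{u}^{i_j}\mathbf{d}^{i_j}$ being the maximal pyramids at altitude $k$), and $w(P)=\beta_k\alpha_{i_1}\cdots\alpha_{i_r}$ (each maximal pyramid of height $i$ at altitude $\ge1$ contributes $\alpha_i$, and the initial segment $\mathbf{u}^k$ contributes $\beta_k$). Only paths of nonzero weight are kept in $\mathcal{A}_n$. Let $\mathcal{V}_n$ be the set of Dyck paths of length $2n$ that are concatenations $P_1P_2\cdots P_m$ ($m\ge0$; $m=0$ gives the empty path) of paths $P_j\in\bigcup_{s\ge1}\mathcal{A}_s$, with weight $w(P_1\cdots P_m)=\prod_j w(P_j)$ (the empty path has weight $1$), and let $V_n=\sum_{P\in\mathcal{V}_n}w(P)$. -}

module Defs where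

open import Level using (Level)
open import Data.Bool using (Bool; true; false; if_then_else_; _∧_)
open import Data.Nat using (ℕ; zero; suc; _∸_; _≡ᵇ_; _≤ᵇ_) renaming (_+_ to _+ℕ_)
open import Data.List using (List; []; _∷_; _++_; map; length; reverse; filterᵇ; foldr)

allB : {A : Set} → (A → Bool) → List A → Bool
allB p [] = true
allB p (x ∷ xs) = p x ∧ allB p xs
open import Data.Maybe using (Maybe; just; nothing)
open import Data.Product using (_×_; _,_)
open import Algebra.Bundles using (CommutativeRing)

data Step : Set where
  U D : Step

words : ℕ → List (List Step)
words zero    = [] ∷ []
words (suc m) = map (U ∷_) (words m) ++ map (D ∷_) (words m)

dyckFrom : ℕ → List Step → Bool
dyckFrom h       []       = h ≡ᵇ 0
dyckFrom h       (U ∷ w)  = dyckFrom (suc h) w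
dyckFrom zero    (D ∷ w)  = false
dyckFrom (suc h) (D ∷ w)  = dyckFrom h w

isDyck : List Step → Bool
isDyck = dyckFrom 0

height : ℕ → Step → ℕ
height h U = suc h
height h D = h ∸ 1

-- Splitting a Dyck word at its returns to the x-axis: the (unique)
-- factorisation into primitive Dyck words.
compsFrom : ℕ → List Step → List Step → List (List Step)
compsFrom h acc []      = []
compsFrom h acc (s ∷ w) with height h s
... | zero  = reverse (s ∷ acc) ∷ compsFrom 0 [] w
... | suc h' = compsFrom (suc h') (s ∷ acc) w

primComponents : List Step → List (List Step)
primComponents = compsFrom 0 []

valleysFrom : ℕ → List Step → List ℕ
valleysFrom h (D ∷ w@(U ∷ _)) = (h ∸ 1) ∷ valleysFrom (h ∸ 1) w
valleysFrom h (s ∷ w)         = valleysFrom (height h s) w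
valleysFrom h []              = []

valleyLevels : List Step → List ℕ
valleyLevels = valleysFrom 0

countU : List Step → ℕ × List Step
countU (U ∷ w) with countU w
... | (i , r) = (suc i , r)
countU w = (0 , w)

countD : List Step → ℕ × List Step
countD (D ∷ w) with countD w
... | (i , r) = (suc i , r)
countD w = (0 , w)

-- parse a word as a sequence of pyramids u^i d^i (i ≥ 1); returns heights
pyramidsF : ℕ → List Step → Maybe (List ℕ)
pyramidsF _        []  = just []
pyramidsF zero     (_ ∷ _) = nothing
pyramidsF (suc f)  w@(_ ∷ _) with countU w
... | (i , w1) with countD w1
...   | (j , w2) with (i ≡ᵇ j) ∧ (1 ≤ᵇ i) | pyramidsF f w2
...     | true  | just is = just (i ∷ is)
...     | _     | _       = nothing

pyramids : List Step → Maybe (List ℕ)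
pyramids w = pyramidsF (length w) w

stripL : Step → ℕ → List Step → Maybe (List Step)
stripL s zero    w       = just w
stripL U (suc k) (U ∷ w) = stripL U k w
stripL D (suc k) (D ∷ w) = stripL D k w
stripL _ (suc k) _       = nothing

middle : ℕ → List Step → Maybe (List Step)
middle k w with stripL U k w
... | nothing = nothing
... | just w' with stripL D k (reverse w')
...   | nothing = nothing
...   | just m  = just (reverse m)

module _ {c ℓ : Level} (R : CommutativeRing c ℓ) where
  open CommutativeRing R

  sumR : List Carrier → Carrier
  sumR = foldr _+_ 0#

  prodR : List Carrier → Carrier
  prodR = foldr _*_ 1#

  -- weight of a primitive Dyck word P as an element of 𝒜 (0 if P ∉ 𝒜):
  --  * no valley:  P = u^n d^n, weight γ_n;
  --  * all valleys at a common level k ≥ 1 and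
  --    P = u^k u^{i_1} d^{i_1} ... u^{i_r} d^{i_r} d^k with r ≥ 2:
  --    weight β_k α_{i_1} ... α_{i_r};
  --  * otherwise P ∉ 𝒜 (weight 0).
  weightA : (α β γ : ℕ → Carrier) → List Step → Carrier
  weightA α β γ w with valleyLevels w
  ... | [] with pyramids w
  ...   | just (n ∷ []) = γ n
  ...   | _             = 0#
  weightA α β γ w | zero ∷ ks = 0#
  weightA α β γ w | suc k ∷ ks with allB (λ l → l ≡ᵇ suc k) ks | middle (suc k) w
  ... | true | just m with pyramids m
  ...   | just is@(_ ∷ _ ∷ _) = β (suc k) * prodR (map α is)
  ...   | _                   = 0#
  weightA α β γ w | suc k ∷ ks | _ | _ = 0#

  -- weight of a Dyck path as an element of 𝒱: product of the weights of
  -- its primitive factors (the factorisation into elements of 𝒜 is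
  -- necessarily the factorisation into primitive Dyck paths)
  weightV : (α β γ : ℕ → Carrier) → List Step → Carrier
  weightV α β γ w = prodR (map (weightA α β γ) (primComponents w))

  V : (α β γ : ℕ → Carrier) → ℕ → Carrier
  V α β γ n = sumR (map (weightV α β γ) (filterᵇ isDyck (words (n +ℕ n))))

  PS : Set c
  PS = ℕ → Carrier

  sumUpTo : ℕ → (ℕ → Carrier) → Carrier
  sumUpTo zero    f = f 0
  sumUpTo (suc n) f = sumUpTo n f + f (suc n)

  oneS : PS
  oneS zero    = 1#
  oneS (suc _) = 0#

  _⊕_ : PS → PS → PS
  (f ⊕ g) n = f n + g n

  _⊖_ : PS → PS → PS
  (f ⊖ g) n = f n - g n

  _⊛_ : PS → PS → PS
  (f ⊛ g) n = sumUpTo n (λ i → f i * g (n ∸ i))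

  series₁ : (ℕ → Carrier) → PS
  series₁ a zero    = 0#
  series₁ a (suc k) = a (suc k)

  _≈S_ : PS → PS → Set ℓ
  f ≈S g = ∀ n → f n ≈ g n

module Submission where

-- A Dyck path factors uniquely into primitive paths, so Σ V_n xⁿ = 1/(1 - P) where P is the generating
-- function of the weighted primitive paths.  A primitive path of nonzero weight is either a pyramid uⁿdⁿ,
-- of weight γ_n, or u^k m d^k with m a sequence of r ≥ 2 pyramids, of weight β_k α_{i₁}⋯α_{i_r}; in the
-- second case k is the common level of the valleys, so the two shapes do not overlap.  Sequences of at
-- least j pyramids have generating function α^j/(1 - α), hence P = γ + β α²/(1 - α).
--
-- Generating functions are first formed by word length, i.e. in x^½.  All paths have even length, and
-- for series without odd coefficients, taking every other coefficient (`halve`) commutes with the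
-- Cauchy product.

open import Algebra.Bundles using (CommutativeRing)
open import Data.Bool using (Bool; true; false; if_then_else_; _∧_)
open import Data.Bool.Properties using (T-≡; T-∧)
open import Data.Empty using (⊥-elim)
import Data.List as List
open import Data.List using (List; []; _∷_; _++_; map; length; reverse; replicate; null; filterᵇ)
open import Data.List.Properties
  using ( ++-assoc; ++-identityʳ; length-++; length-++-≤ʳ; length-replicate; map-++; map-∘
        ; reverse-++; reverse-involutive; unfold-reverse; ∷-injective; ∷-injectiveʳ )
open import Data.List.Relation.Unary.All using (All; []; _∷_)
open import Data.Maybe using (just; nothing)
open import Data.Nat using (ℕ; zero; suc; _∸_; _≤_; _<_; z≤n; s≤s; _≡ᵇ_; _≤ᵇ_; ⌊_/2⌋; parity)
  renaming (_+_ to _+ℕ_)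
import Data.Nat.Properties as ℕ
open import Data.Nat.Tactic.RingSolver using (solve-∀)
open import Data.Parity.Base using (0ℙ; 1ℙ)
open import Data.Product using (Σ-syntax; _×_; _,_; proj₁; proj₂)
open import Data.Sum using (_⊎_; inj₁; inj₂)
open import Function using (_∘_)
open import Function.Bundles using (Equivalence)
open import Relation.Binary.Bundles using (Setoid)
import Relation.Binary.Reasoning.Setoid
import Relation.Binary.PropositionalEquality as ≡
open ≡ using (_≡_; _≢_)
open import Relation.Nullary using (¬_; Dec; yes; no)

open import Defs

module DyckWords where

  open import Data.Nat using (_+_)
  open ≡
  open import Data.Nat.Properties
    using ( +-suc; +-identityʳ; +-cancelʳ-≡; +-mono-<; +-monoʳ-≤; m≤n+m; suc-injective; ≡ᵇ⇒≡; ≤ᵇ⇒≤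
          ; ≤-trans; ≤-reflexive; ≮⇒≥; <⇒≱; n≡⌊n+n/2⌋ )

  parity-even : ∀ n → parity (n + n) ≡ 0ℙ
  parity-even zero    = refl
  parity-even (suc n) rewrite +-suc n n = parity-even n

  parity-odd : ∀ n → parity (suc (n + n)) ≡ 1ℙ
  parity-odd zero    = refl
  parity-odd (suc n) rewrite +-suc n n = parity-odd n

  even≢odd : ∀ m n → m + m ≢ suc (n + n)
  even≢odd m n e with trans (sym (parity-even m)) (trans (cong parity e) (parity-odd n))
  ... | ()

  +-self-injective : ∀ {m n} → m + m ≡ n + n → m ≡ n
  +-self-injective {m} {n} e = trans (n≡⌊n+n/2⌋ m) (trans (cong ⌊_/2⌋ e) (sym (n≡⌊n+n/2⌋ n)))

  +-self-cancel-≤ : ∀ {m n} → m + m ≤ n + n → m ≤ n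
  +-self-cancel-≤ le = ≮⇒≥ (λ n<m → <⇒≱ (+-mono-< n<m n<m) le)

  ≡ᵇ-refl : ∀ n → (n ≡ᵇ n) ≡ true
  ≡ᵇ-refl zero    = refl
  ≡ᵇ-refl (suc n) = ≡ᵇ-refl n

  ≤ᵇ-suc : ∀ m n → (suc m ≤ᵇ suc n) ≡ (m ≤ᵇ n)
  ≤ᵇ-suc zero    n = refl
  ≤ᵇ-suc (suc m) n = refl

  ups downs : ℕ → List Step
  ups n   = replicate n U
  downs n = replicate n D

  pyramid : ℕ → List Step
  pyramid i = ups i ++ downs i

  pyramidSeq : List ℕ → List Step
  pyramidSeq []       = []
  pyramidSeq (i ∷ is) = pyramid i ++ pyramidSeq is

  AllPositive : List ℕ → Set
  AllPositive = All (0 <_)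

  downs-++ : ∀ m n → downs m ++ downs n ≡ downs (m + n)
  downs-++ zero    n = refl
  downs-++ (suc m) n = cong (D ∷_) (downs-++ m n)

  reverse-downs : ∀ n → reverse (downs n) ≡ downs n
  reverse-downs zero    = refl
  reverse-downs (suc n) = begin
    reverse (D ∷ downs n)   ≡⟨ unfold-reverse D (downs n) ⟩
    reverse (downs n) ++ _  ≡⟨ cong (_++ D ∷ []) (reverse-downs n) ⟩
    downs n ++ downs 1      ≡⟨ downs-++ n 1 ⟩
    downs (n + 1)           ≡⟨ cong downs (+-suc n 0) ⟩
    D ∷ downs (n + 0)       ≡⟨ cong (λ k → D ∷ downs k) (+-identityʳ n) ⟩
    D ∷ downs n             ∎
    where open ≡-Reasoning

  pyramid-++ : ∀ i r t → (pyramid i ++ r) ++ t ≡ ups i ++ downs i ++ r ++ t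
  pyramid-++ i r t = trans (++-assoc (pyramid i) r t) (++-assoc (ups i) (downs i) (r ++ t))

  length-pyramid : ∀ i → length (pyramid i) ≡ i + i
  length-pyramid i = trans (length-++ (ups i)) (cong₂ _+_ (length-replicate i) (length-replicate i))

  length-frame : ∀ k m → length (ups k ++ m ++ downs k) ≡ k + (length m + k)
  length-frame k m = begin
    length (ups k ++ m ++ downs k)                ≡⟨ length-++ (ups k) ⟩
    length (ups k) + length (m ++ downs k)        ≡⟨ cong₂ _+_ (length-replicate k) (length-++ m) ⟩
    k + (length m + length (downs k))             ≡⟨ cong (λ n → k + (length m + n)) (length-replicate k) ⟩
    k + (length m + k)                            ∎
    where open ≡-Reasoning

  ++-injective : ∀ {A : Set} (a a′ x x′ : List A) → length a ≡ length a′ → a ++ x ≡ a′ ++ x′ →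
    a ≡ a′ × x ≡ x′
  ++-injective []      []        x x′ _ e = refl , e
  ++-injective (s ∷ a) (s′ ∷ a′) x x′ l e with ∷-injective e
  ... | refl , e′ with ++-injective a a′ x x′ (suc-injective l) e′
  ...   | refl , e″ = refl , e″

  countU-correct : ∀ w → w ≡ ups (proj₁ (countU w)) ++ proj₂ (countU w)
  countU-correct (U ∷ w) with countU w | countU-correct w
  ... | (i , r) | eq = cong (U ∷_) eq
  countU-correct []      = refl
  countU-correct (D ∷ w) = refl

  countD-correct : ∀ w → w ≡ downs (proj₁ (countD w)) ++ proj₂ (countD w)
  countD-correct (D ∷ w) with countD w | countD-correct w
  ... | (i , r) | eq = cong (D ∷_) eq
  countD-correct []      = refl
  countD-correct (U ∷ w) = refl

  countU-ups : ∀ i w → countU (ups i ++ D ∷ w) ≡ (i , D ∷ w)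
  countU-ups zero    w = refl
  countU-ups (suc i) w rewrite countU-ups i w = refl

  countD-downs : ∀ i is → AllPositive is → countD (downs i ++ pyramidSeq is) ≡ (i , pyramidSeq is)
  countD-downs zero    []           _        = refl
  countD-downs zero    (suc j ∷ is) _        = refl
  countD-downs zero    (zero ∷ is)  (() ∷ _)
  countD-downs (suc i) is           hs rewrite countD-downs i is hs = refl

  pyramidTest-sound : ∀ {i j} → (i ≡ᵇ j) ∧ (1 ≤ᵇ i) ≡ true → i ≡ j × 0 < i
  pyramidTest-sound {i} {j} t with Equivalence.to T-∧ (Equivalence.from T-≡ t)
  ... | i≡j , 0<i = ≡ᵇ⇒≡ i j i≡j , ≤ᵇ⇒≤ 1 i 0<i

  pyramidsF-sound : ∀ f w {is} → pyramidsF f w ≡ just is → w ≡ pyramidSeq is × AllPositive is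
  pyramidsF-sound f       []      refl = refl , []
  pyramidsF-sound zero    (_ ∷ _) ()
  pyramidsF-sound (suc f) w@(_ ∷ _) e with countU w in eU
  ... | (i , w₁) with countD w₁ in eD
  ...   | (j , w₂) with (i ≡ᵇ j) ∧ (1 ≤ᵇ i) in t | pyramidsF f w₂ in rest
  pyramidsF-sound (suc f) w@(_ ∷ _) refl | i , w₁ | j , w₂ | true | just is
    with pyramidTest-sound {i} {j} t | pyramidsF-sound f w₂ rest
  ... | refl , 0<i | refl , hs = w≡ , 0<i ∷ hs
    where
    open ≡-Reasoning
    w≡ : w ≡ pyramidSeq (i ∷ is)
    w≡ = begin
      w                                       ≡⟨ countU-correct w ⟩
      ups _ ++ proj₂ (countU w)               ≡⟨ cong (λ p → ups (proj₁ p) ++ proj₂ p) eU ⟩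
      ups i ++ w₁                             ≡⟨ cong (ups i ++_) (countD-correct w₁) ⟩
      ups i ++ (downs _ ++ proj₂ (countD w₁)) ≡⟨ cong (λ p → ups i ++ (downs (proj₁ p) ++ proj₂ p)) eD ⟩
      ups i ++ (downs i ++ w₂)                ≡⟨ ++-assoc (ups i) (downs i) w₂ ⟨
      pyramidSeq (i ∷ is)                     ∎
  pyramidsF-sound (suc f) (_ ∷ _) () | _ , _ | _ , _ | true  | nothing
  pyramidsF-sound (suc f) (_ ∷ _) () | _ , _ | _ , _ | false | _

  pyramids-sound : ∀ w {is} → pyramids w ≡ just is → w ≡ pyramidSeq is × AllPositive is
  pyramids-sound w = pyramidsF-sound (length w) w

  pyramidsF-complete : ∀ f is → AllPositive is → length (pyramidSeq is) ≤ f →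
    pyramidsF f (pyramidSeq is) ≡ just is
  pyramidsF-complete zero    []           _        _ = refl
  pyramidsF-complete (suc f) []           _        _ = refl
  pyramidsF-complete _       (zero ∷ _)   (() ∷ _) _
  pyramidsF-complete zero    (suc i ∷ is) _        ()
  pyramidsF-complete (suc f) (suc i ∷ is) (_ ∷ hs) (s≤s fuel)
    rewrite ++-assoc (ups i) (D ∷ downs i) (pyramidSeq is)
          | countU-ups i (downs i ++ pyramidSeq is)
          | countD-downs i is hs
          | ≡ᵇ-refl i
          | pyramidsF-complete f is hs
              (≤-trans (length-++-≤ʳ (pyramidSeq is) {D ∷ downs i}) (≤-trans (length-++-≤ʳ _ {ups i}) fuel))
          = refl

  pyramids-pyramidSeq : ∀ is → AllPositive is → pyramids (pyramidSeq is) ≡ just is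
  pyramids-pyramidSeq is hs = pyramidsF-complete _ is hs (≤-reflexive refl)

  pyramidSeq-[_] : ∀ i → pyramidSeq (i ∷ []) ≡ pyramid i
  pyramidSeq-[ i ] = ++-identityʳ (pyramid i)

  pyramids-pyramid : ∀ {i} → 0 < i → pyramids (pyramid i) ≡ just (i ∷ [])
  pyramids-pyramid {i} 0<i =
    subst (λ w → pyramids w ≡ just (i ∷ [])) pyramidSeq-[ i ] (pyramids-pyramidSeq (i ∷ []) (0<i ∷ []))

  pyramids-single : ∀ w {i} → pyramids w ≡ just (i ∷ []) → w ≡ pyramid i × 0 < i
  pyramids-single w {i} e with pyramids-sound w e
  ... | w≡ , (0<i ∷ []) = trans w≡ pyramidSeq-[ i ] , 0<i

  pyramids-single-length : ∀ w {i} → pyramids w ≡ just (i ∷ []) → length w ≡ i + i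
  pyramids-single-length w {i} e = trans (cong length (proj₁ (pyramids-single w e))) (length-pyramid i)

  pyramids-cons : ∀ p r {i is} → pyramids p ≡ just (i ∷ []) → pyramids r ≡ just is →
    pyramids (p ++ r) ≡ just (i ∷ is)
  pyramids-cons p r ep er with pyramids-single p ep | pyramids-sound r er
  ... | refl , 0<i | refl , hs = pyramids-pyramidSeq (_ ∷ _) (0<i ∷ hs)

  -- Primitive paths and the first-return decomposition

  -- primitiveFrom h p: started at height h, the path p first reaches the axis with its last step
  primitiveFrom : ℕ → List Step → Bool
  primitiveFrom h             (U ∷ w) = primitiveFrom (suc h) w
  primitiveFrom _             []      = false
  primitiveFrom zero          (D ∷ _) = false
  primitiveFrom (suc zero)    (D ∷ w) = null w
  primitiveFrom (suc (suc h)) (D ∷ w) = primitiveFrom (suc h) w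

  isPrimitive : List Step → Bool
  isPrimitive = primitiveFrom 0

  primitiveFrom-++-dyck : ∀ h p r → primitiveFrom h p ≡ true → isDyck r ≡ true → dyckFrom h (p ++ r) ≡ true
  primitiveFrom-++-dyck h             (U ∷ p)  r e d = primitiveFrom-++-dyck (suc h) p r e d
  primitiveFrom-++-dyck (suc zero)    (D ∷ []) r e d = d
  primitiveFrom-++-dyck (suc (suc h)) (D ∷ p)  r e d = primitiveFrom-++-dyck (suc h) p r e d

  dyckFrom-firstReturn : ∀ h w → dyckFrom (suc h) w ≡ true →
    Σ[ p ∈ List Step ] Σ[ r ∈ List Step ] p ++ r ≡ w × primitiveFrom (suc h) p ≡ true × isDyck r ≡ true
  dyckFrom-firstReturn h (U ∷ w) d with dyckFrom-firstReturn (suc h) w d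
  ... | p , r , refl , prim , dyck = U ∷ p , r , refl , prim , dyck
  dyckFrom-firstReturn zero    (D ∷ w) d = D ∷ [] , w , refl , refl , d
  dyckFrom-firstReturn (suc h) (D ∷ w) d with dyckFrom-firstReturn h w d
  ... | p , r , refl , prim , dyck = D ∷ p , r , refl , prim , dyck

  primitiveFrom-prefix-unique : ∀ h p r p′ r′ → p ++ r ≡ p′ ++ r′ →
    primitiveFrom h p ≡ true → primitiveFrom h p′ ≡ true → p ≡ p′
  primitiveFrom-prefix-unique h (U ∷ p) r (U ∷ p′) r′ e q q′ =
    cong (U ∷_) (primitiveFrom-prefix-unique (suc h) p r p′ r′ (∷-injectiveʳ e) q q′)
  primitiveFrom-prefix-unique (suc zero) (D ∷ []) r (D ∷ []) r′ e q q′ = refl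
  primitiveFrom-prefix-unique (suc (suc h)) (D ∷ p) r (D ∷ p′) r′ e q q′ =
    cong (D ∷_) (primitiveFrom-prefix-unique (suc h) p r p′ r′ (∷-injectiveʳ e) q q′)
  primitiveFrom-prefix-unique h (U ∷ p) r (D ∷ p′) r′ () q q′
  primitiveFrom-prefix-unique h (D ∷ p) r (U ∷ p′) r′ () q q′
  primitiveFrom-prefix-unique (suc zero) (D ∷ []) r (D ∷ _ ∷ _) r′ e q ()
  primitiveFrom-prefix-unique (suc zero) (D ∷ _ ∷ _) r (D ∷ p′) r′ e () q′

  reverse-∷-++ : ∀ (s : Step) acc p → reverse (s ∷ acc) ++ p ≡ reverse acc ++ s ∷ p
  reverse-∷-++ s acc p = trans (cong (_++ p) (unfold-reverse s acc)) (++-assoc (reverse acc) (s ∷ []) p)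

  compsFrom-primitive : ∀ h acc p r → primitiveFrom h p ≡ true →
    compsFrom h acc (p ++ r) ≡ (reverse acc ++ p) ∷ compsFrom 0 [] r
  compsFrom-primitive (suc zero) acc (D ∷ []) r q = cong (_∷ compsFrom 0 [] r) (unfold-reverse D acc)
  compsFrom-primitive h acc (U ∷ p) r q =
    trans (compsFrom-primitive (suc h) (U ∷ acc) p r q) (cong (_∷ compsFrom 0 [] r) (reverse-∷-++ U acc p))
  compsFrom-primitive (suc (suc h)) acc (D ∷ p) r q =
    trans (compsFrom-primitive (suc h) (D ∷ acc) p r q) (cong (_∷ compsFrom 0 [] r) (reverse-∷-++ D acc p))

  primComponents-primitive : ∀ p r → isPrimitive p ≡ true → primComponents (p ++ r) ≡ p ∷ primComponents r
  primComponents-primitive p r = compsFrom-primitive 0 [] p r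

  primitiveFrom-parity : ∀ h p → primitiveFrom h p ≡ true → parity (h + length p) ≡ 0ℙ
  primitiveFrom-parity h (U ∷ p) q rewrite +-suc h (length p) = primitiveFrom-parity (suc h) p q
  primitiveFrom-parity (suc zero) (D ∷ []) q = refl
  primitiveFrom-parity (suc (suc h)) (D ∷ p) q rewrite +-suc h (length p) = primitiveFrom-parity (suc h) p q

  primitiveFrom-ups : ∀ k h w → primitiveFrom h (ups k ++ w) ≡ primitiveFrom (k + h) w
  primitiveFrom-ups zero    h w = refl
  primitiveFrom-ups (suc k) h w rewrite primitiveFrom-ups k (suc h) w | +-suc k h = refl

  primitiveFrom-downs : ∀ n h w → primitiveFrom (suc (n + h)) (downs n ++ w) ≡ primitiveFrom (suc h) w
  primitiveFrom-downs zero    h w = refl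
  primitiveFrom-downs (suc n) h w = primitiveFrom-downs n h w

  primitiveFrom-pyramidSeq : ∀ h is → primitiveFrom (suc h) (pyramidSeq is ++ downs (suc h)) ≡ true
  primitiveFrom-pyramidSeq zero    []       = refl
  primitiveFrom-pyramidSeq (suc h) []       = primitiveFrom-pyramidSeq h []
  primitiveFrom-pyramidSeq h       (i ∷ is)
    rewrite pyramid-++ i (pyramidSeq is) (downs (suc h))
          | primitiveFrom-ups i (suc h) (downs i ++ pyramidSeq is ++ downs (suc h))
          | +-suc i h
          | primitiveFrom-downs i h (pyramidSeq is ++ downs (suc h))
          = primitiveFrom-pyramidSeq h is

  isPrimitive-frame : ∀ k is → isPrimitive (ups (suc k) ++ pyramidSeq is ++ downs (suc k)) ≡ true
  isPrimitive-frame k is rewrite primitiveFrom-ups (suc k) 0 (pyramidSeq is ++ downs (suc k)) | +-identityʳ k =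
    primitiveFrom-pyramidSeq k is

  isPrimitive-pyramid : ∀ {i} → 0 < i → isPrimitive (pyramid i) ≡ true
  isPrimitive-pyramid {suc k} _ = isPrimitive-frame k []

  valleysFrom-ups : ∀ k h w → valleysFrom h (ups k ++ w) ≡ valleysFrom (k + h) w
  valleysFrom-ups zero    h w = refl
  valleysFrom-ups (suc k) h w rewrite valleysFrom-ups k (suc h) w | +-suc k h = refl

  valleysFrom-downs : ∀ n h → valleysFrom h (downs n) ≡ []
  valleysFrom-downs zero          h = refl
  valleysFrom-downs (suc zero)    h = refl
  valleysFrom-downs (suc (suc n)) h = valleysFrom-downs (suc n) (h ∸ 1)

  valleysFrom-downs-U : ∀ n h r → valleysFrom (suc n + h) (downs (suc n) ++ U ∷ r) ≡ h ∷ valleysFrom h (U ∷ r)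
  valleysFrom-downs-U zero    h r = refl
  valleysFrom-downs-U (suc n) h r = valleysFrom-downs-U n h r

  valleysFrom-pyramidSeq : ∀ h i is k → AllPositive (i ∷ is) →
    valleysFrom h (pyramidSeq (i ∷ is) ++ downs k) ≡ replicate (length is) h
  valleysFrom-pyramidSeq h i [] k _ = begin
    valleysFrom h ((pyramid i ++ []) ++ downs k)     ≡⟨ cong (valleysFrom h) (pyramid-++ i [] (downs k)) ⟩
    valleysFrom h (ups i ++ downs i ++ downs k)      ≡⟨ valleysFrom-ups i h _ ⟩
    valleysFrom (i + h) (downs i ++ downs k)         ≡⟨ cong (valleysFrom (i + h)) (downs-++ i k) ⟩
    valleysFrom (i + h) (downs (i + k))              ≡⟨ valleysFrom-downs (i + k) (i + h) ⟩
    []                                               ∎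
    where open ≡-Reasoning
  valleysFrom-pyramidSeq h (suc i) (suc j ∷ is) k (_ ∷ hs) = begin
    valleysFrom h ((pyramid (suc i) ++ rest) ++ downs k)
      ≡⟨ cong (valleysFrom h) (pyramid-++ (suc i) rest (downs k)) ⟩
    valleysFrom h (ups (suc i) ++ downs (suc i) ++ rest ++ downs k)
      ≡⟨ valleysFrom-ups (suc i) h _ ⟩
    valleysFrom (suc i + h) (downs (suc i) ++ rest ++ downs k)
      ≡⟨ valleysFrom-downs-U i h _ ⟩
    h ∷ valleysFrom h (rest ++ downs k)
      ≡⟨ cong (h ∷_) (valleysFrom-pyramidSeq h (suc j) is k hs) ⟩
    h ∷ replicate (length is) h
      ∎
    where
    open ≡-Reasoning
    rest = pyramidSeq (suc j ∷ is)
  valleysFrom-pyramidSeq h (suc i) (zero ∷ is) k (_ ∷ () ∷ _)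

  valleyLevels-frame : ∀ k i is → AllPositive (i ∷ is) →
    valleyLevels (ups k ++ pyramidSeq (i ∷ is) ++ downs k) ≡ replicate (length is) k
  valleyLevels-frame k i is hs rewrite valleysFrom-ups k 0 (pyramidSeq (i ∷ is) ++ downs k) | +-identityʳ k =
    valleysFrom-pyramidSeq k i is k hs

  valleyLevels-pyramid : ∀ i → valleyLevels (pyramid i) ≡ []
  valleyLevels-pyramid i rewrite valleysFrom-ups i 0 (downs i) = valleysFrom-downs i (i + 0)

  stripL-correct : ∀ s k w {w′} → stripL s k w ≡ just w′ → w ≡ replicate k s ++ w′
  stripL-correct s zero    w       refl = refl
  stripL-correct U (suc k) (U ∷ w) e    = cong (U ∷_) (stripL-correct U k w e)
  stripL-correct D (suc k) (D ∷ w) e    = cong (D ∷_) (stripL-correct D k w e)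
  stripL-correct U (suc k) (D ∷ w) ()
  stripL-correct D (suc k) (U ∷ w) ()
  stripL-correct U (suc k) []      ()
  stripL-correct D (suc k) []      ()

  stripL-replicate : ∀ s k w → stripL s k (replicate k s ++ w) ≡ just w
  stripL-replicate s zero    w = refl
  stripL-replicate U (suc k) w = stripL-replicate U k w
  stripL-replicate D (suc k) w = stripL-replicate D k w

  middle-correct : ∀ k w {m} → middle k w ≡ just m → w ≡ ups k ++ m ++ downs k
  middle-correct k w e with stripL U k w in e₁
  ... | just w′ with stripL D k (reverse w′) in e₂
  middle-correct k w refl | just w′ | just m′ = trans (stripL-correct U k w e₁) (cong (ups k ++_) w′≡)
    where
    open ≡-Reasoning
    w′≡ : w′ ≡ reverse m′ ++ downs k
    w′≡ = begin
      w′                              ≡⟨ reverse-involutive w′ ⟨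
      reverse (reverse w′)            ≡⟨ cong reverse (stripL-correct D k (reverse w′) e₂) ⟩
      reverse (downs k ++ m′)         ≡⟨ reverse-++ (downs k) m′ ⟩
      reverse m′ ++ reverse (downs k) ≡⟨ cong (reverse m′ ++_) (reverse-downs k) ⟩
      reverse m′ ++ downs k           ∎
  middle-correct k w () | just w′ | nothing
  middle-correct k w () | nothing

  middle-frame : ∀ k m → middle k (ups k ++ m ++ downs k) ≡ just m
  middle-frame k m
    rewrite stripL-replicate U k (m ++ downs k) | reverse-++ m (downs k) | reverse-downs k
          | stripL-replicate D k (reverse m) | reverse-involutive m
          = refl

  middle-frame-unique : ∀ k a m b {m′} → length a ≡ k → length b ≡ k → middle k (a ++ m ++ b) ≡ just m′ →
    a ≡ ups k × b ≡ downs k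
  middle-frame-unique k a m b {m′} la lb e
    with ++-injective a (ups k) (m ++ b) (m′ ++ downs k) (trans la (sym (length-replicate k))) (middle-correct k _ e)
  ... | a≡ , rest = a≡ , proj₂ (++-injective m m′ b (downs k) same-length rest)
    where
    open ≡-Reasoning
    same-length : length m ≡ length m′
    same-length = +-cancelʳ-≡ _ _ _ (begin
      length m + length b           ≡⟨ length-++ m ⟨
      length (m ++ b)               ≡⟨ cong length rest ⟩
      length (m′ ++ downs k)        ≡⟨ length-++ m′ ⟩
      length m′ + length (downs k)  ≡⟨ cong (length m′ +_) (trans (length-replicate k) (sym lb)) ⟩
      length m′ + length b          ∎)

  -- Framed sequences u^k P₁⋯P_r d^k of r ≥ 2 pyramids

  record Framed (k : ℕ) (w : List Step) : Set where
    constructor framed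
    field
      {inner}   : List Step
      {i j}     : ℕ
      {is}      : List ℕ
      middle≡   : middle k w ≡ just inner
      pyramids≡ : pyramids inner ≡ just (i ∷ j ∷ is)

  module _ {k w} (F : Framed k w) where
    open Framed F

    Framed-shape : w ≡ ups k ++ pyramidSeq (i ∷ j ∷ is) ++ downs k × AllPositive (i ∷ j ∷ is)
    Framed-shape with pyramids-sound inner pyramids≡
    ... | inner≡ , hs = trans (middle-correct k w middle≡) (cong (λ m → ups k ++ m ++ downs k) inner≡) , hs

    Framed-valleys : valleyLevels w ≡ k ∷ replicate (length is) k
    Framed-valleys =
      trans (cong valleyLevels (proj₁ Framed-shape)) (valleyLevels-frame k i (j ∷ is) (proj₂ Framed-shape))

    Framed-length : k + k ≤ length w
    Framed-length = subst (k + k ≤_) (sym (trans (cong length (middle-correct k w middle≡)) (length-frame k inner)))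
                          (+-monoʳ-≤ k (m≤n+m k (length inner)))

  Framed-primitive : ∀ {k w} → Framed (suc k) w → isPrimitive w ≡ true
  Framed-primitive {k} F = trans (cong isPrimitive (proj₁ (Framed-shape F))) (isPrimitive-frame k (i ∷ j ∷ is))
    where open Framed F

  Framed-head : ∀ {k w l ls} → Framed k w → valleyLevels w ≡ l ∷ ls → l ≡ k
  Framed-head F v with trans (sym v) (Framed-valleys F)
  ... | refl = refl

  Framed-unique : ∀ {k k′ w} → Framed k w → Framed k′ w → k ≡ k′
  Framed-unique F F′ = Framed-head F′ (Framed-valleys F)

  ¬Framed : ∀ {k w m r} → middle k w ≡ just m → pyramids m ≡ r → (∀ {i j is} → r ≢ just (i ∷ j ∷ is)) →
    ¬ Framed k w
  ¬Framed e₁ e₂ r≢ (framed e₁′ e₂′) with trans (sym e₁) e₁′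
  ... | refl = r≢ (trans (sym e₂) e₂′)

  framed? : ∀ k w → Dec (Framed k w)
  framed? k w with middle k w in e₁
  ... | nothing = no λ { (framed e _) → nothing≢just (trans (sym e₁) e) }
    where
    nothing≢just : ∀ {m : List Step} → nothing ≢ just m
    nothing≢just ()
  ... | just m with pyramids m in e₂
  ...   | just (_ ∷ _ ∷ _) = yes (framed e₁ e₂)
  ...   | just []          = no (¬Framed e₁ e₂ λ ())
  ...   | just (_ ∷ [])    = no (¬Framed e₁ e₂ λ ())
  ...   | nothing          = no (¬Framed e₁ e₂ λ ())

open DyckWords

module PowerSeries {c ℓ} (R : CommutativeRing c ℓ) where

  open CommutativeRing R
  open import Algebra.Properties.Ring ring using (-1*x≈-x)
  open import Algebra.Properties.AbelianGroup +-abelianGroup using (⁻¹-∙-comm)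

  module ≈-Reasoning = Relation.Binary.Reasoning.Setoid setoid

  infixl 7 _⋆_
  infixl 6 _⊞_ _⊟_
  infix  4 _≋_

  𝟙 : PS R
  𝟙 = oneS R

  _⋆_ _⊞_ _⊟_ : PS R → PS R → PS R
  _⋆_ = _⊛_ R
  _⊞_ = _⊕_ R
  _⊟_ = _⊖_ R

  _≋_ : PS R → PS R → Set ℓ
  _≋_ = _≈S_ R

  ≋-setoid : Setoid c ℓ
  ≋-setoid = record
    { Carrier       = PS R
    ; _≈_           = _≋_
    ; isEquivalence = record
      { refl  = λ _ → refl
      ; sym   = λ p n → sym (p n)
      ; trans = λ p q n → trans (p n) (q n)
      }
    }

  module ≋-Reasoning = Relation.Binary.Reasoning.Setoid ≋-setoid

  open Setoid ≋-setoid public using () renaming (refl to ≋-refl; sym to ≋-sym; trans to ≋-trans)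

  x+y-y≈x : ∀ x y → x + y - y ≈ x
  x+y-y≈x x y = trans (+-assoc x y (- y)) (trans (+-congˡ (-‿inverseʳ y)) (+-identityʳ x))

  x≈0∧y≈0⇒x+y≈0 : ∀ {x y} → x ≈ 0# → y ≈ 0# → x + y ≈ 0#
  x≈0∧y≈0⇒x+y≈0 p q = trans (+-cong p q) (+-identityʳ 0#)

  +-interchange : ∀ a b c d → (a + b) + (c + d) ≈ (a + c) + (b + d)
  +-interchange a b c d = begin
    (a + b) + (c + d)  ≈⟨ +-assoc a b (c + d) ⟩
    a + (b + (c + d))  ≈⟨ +-congˡ (+-assoc b c d) ⟨
    a + ((b + c) + d)  ≈⟨ +-congˡ (+-congʳ (+-comm b c)) ⟩
    a + ((c + b) + d)  ≈⟨ +-congˡ (+-assoc c b d) ⟩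
    a + (c + (b + d))  ≈⟨ +-assoc a c (b + d) ⟨
    (a + c) + (b + d)  ∎
    where open ≈-Reasoning

  sumUpTo-cong : ∀ n {f g} → (∀ i → i ≤ n → f i ≈ g i) → sumUpTo R n f ≈ sumUpTo R n g
  sumUpTo-cong zero    f≈g = f≈g 0 z≤n
  sumUpTo-cong (suc n) f≈g = +-cong (sumUpTo-cong n (λ i i≤n → f≈g i (ℕ.m≤n⇒m≤1+n i≤n))) (f≈g (suc n) ℕ.≤-refl)

  sumUpTo-vanish : ∀ n {f} → (∀ i → i ≤ n → f i ≈ 0#) → sumUpTo R n f ≈ 0#
  sumUpTo-vanish zero    f≈0 = f≈0 0 z≤n
  sumUpTo-vanish (suc n) f≈0 =
    x≈0∧y≈0⇒x+y≈0 (sumUpTo-vanish n (λ i i≤n → f≈0 i (ℕ.m≤n⇒m≤1+n i≤n))) (f≈0 (suc n) ℕ.≤-refl)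

  sumUpTo-single : ∀ n j {f} → j ≤ n → (∀ i → i ≢ j → f i ≈ 0#) → sumUpTo R n f ≈ f j
  sumUpTo-single zero    zero z≤n   off = refl
  sumUpTo-single (suc n) j    j≤1+n off with j ℕ.≟ suc n
  ... | yes ≡.refl = trans (+-congʳ (sumUpTo-vanish n (λ i i≤n → off i (ℕ.<⇒≢ (s≤s i≤n))))) (+-identityˡ _)
  ... | no j≢1+n   = trans
    (+-cong (sumUpTo-single n j (ℕ.≤-pred (ℕ.≤∧≢⇒< j≤1+n j≢1+n)) off) (off (suc n) (j≢1+n ∘ ≡.sym)))
    (+-identityʳ _)

  sumUpTo-+ : ∀ n f g → sumUpTo R n (λ i → f i + g i) ≈ sumUpTo R n f + sumUpTo R n g
  sumUpTo-+ zero    f g = refl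
  sumUpTo-+ (suc n) f g = trans (+-congʳ (sumUpTo-+ n f g)) (+-interchange _ _ _ _)

  sumUpTo-*ˡ : ∀ n x f → sumUpTo R n (λ i → x * f i) ≈ x * sumUpTo R n f
  sumUpTo-*ˡ zero    x f = refl
  sumUpTo-*ˡ (suc n) x f = trans (+-congʳ (sumUpTo-*ˡ n x f)) (sym (distribˡ x _ _))

  sumUpTo-suc : ∀ n f → sumUpTo R (suc n) f ≈ f 0 + sumUpTo R n (f ∘ suc)
  sumUpTo-suc zero    f = refl
  sumUpTo-suc (suc n) f = trans (+-congʳ (sumUpTo-suc n f)) (+-assoc _ _ _)

  ⋆-suc : ∀ f g n → (f ⋆ g) (suc n) ≈ f 0 * g (suc n) + ((f ∘ suc) ⋆ g) n
  ⋆-suc f g n = sumUpTo-suc n (λ i → f i * g (suc n ∸ i))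

  ⋆-sucʳ : ∀ f g n → (f ⋆ g) (suc n) ≈ (f ⋆ (g ∘ suc)) n + f (suc n) * g 0
  ⋆-sucʳ f g zero    = ⋆-suc f g 0
  ⋆-sucʳ f g (suc n) = begin
    (f ⋆ g) (suc (suc n))
      ≈⟨ ⋆-suc f g (suc n) ⟩
    f 0 * g (suc (suc n)) + ((f ∘ suc) ⋆ g) (suc n)
      ≈⟨ +-congˡ (⋆-sucʳ (f ∘ suc) g n) ⟩
    f 0 * g (suc (suc n)) + (((f ∘ suc) ⋆ (g ∘ suc)) n + f (suc (suc n)) * g 0)
      ≈⟨ +-assoc _ _ _ ⟨
    (f 0 * g (suc (suc n)) + ((f ∘ suc) ⋆ (g ∘ suc)) n) + f (suc (suc n)) * g 0
      ≈⟨ +-congʳ (⋆-suc f (g ∘ suc) n) ⟨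
    (f ⋆ (g ∘ suc)) (suc n) + f (suc (suc n)) * g 0
      ∎
    where open ≈-Reasoning

  ⋆-cong : ∀ {f f′ g g′} → f ≋ f′ → g ≋ g′ → f ⋆ g ≋ f′ ⋆ g′
  ⋆-cong f≋f′ g≋g′ n = sumUpTo-cong n (λ i _ → *-cong (f≋f′ i) (g≋g′ (n ∸ i)))

  ⋆-congˡ : ∀ f {g g′} → g ≋ g′ → f ⋆ g ≋ f ⋆ g′
  ⋆-congˡ f = ⋆-cong {f = f} (λ _ → refl)

  ⋆-congʳ : ∀ {f f′} g → f ≋ f′ → f ⋆ g ≋ f′ ⋆ g
  ⋆-congʳ g f≋f′ = ⋆-cong {g = g} f≋f′ (λ _ → refl)

  ⋆-distribʳ : ∀ f g h → (f ⊞ g) ⋆ h ≋ f ⋆ h ⊞ g ⋆ h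
  ⋆-distribʳ f g h n = trans (sumUpTo-cong n (λ i _ → distribʳ (h (n ∸ i)) (f i) (g i))) (sumUpTo-+ n _ _)

  ⋆-scaleˡ : ∀ x f g → (λ i → x * f i) ⋆ g ≋ (λ n → x * (f ⋆ g) n)
  ⋆-scaleˡ x f g n = trans (sumUpTo-cong n (λ i _ → *-assoc x (f i) (g (n ∸ i)))) (sumUpTo-*ˡ n x _)

  ⋆-negˡ : ∀ f g → (λ i → - f i) ⋆ g ≋ (λ n → - (f ⋆ g) n)
  ⋆-negˡ f g n = begin
    ((λ i → - f i) ⋆ g) n       ≈⟨ ⋆-congʳ g (λ i → sym (-1*x≈-x (f i))) n ⟩
    ((λ i → - 1# * f i) ⋆ g) n  ≈⟨ ⋆-scaleˡ (- 1#) f g n ⟩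
    - 1# * (f ⋆ g) n            ≈⟨ -1*x≈-x _ ⟩
    - (f ⋆ g) n                 ∎
    where open ≈-Reasoning

  ⋆-distribʳ-⊟ : ∀ f g h → (f ⊟ g) ⋆ h ≋ f ⋆ h ⊟ g ⋆ h
  ⋆-distribʳ-⊟ f g h n = trans (⋆-distribʳ f (λ i → - g i) h n) (+-congˡ (⋆-negˡ g h n))

  ⋆-comm : ∀ f g → f ⋆ g ≋ g ⋆ f
  ⋆-comm f g zero    = *-comm (f 0) (g 0)
  ⋆-comm f g (suc n) = begin
    (f ⋆ g) (suc n)                      ≈⟨ ⋆-suc f g n ⟩
    f 0 * g (suc n) + ((f ∘ suc) ⋆ g) n  ≈⟨ +-cong (*-comm _ _) (⋆-comm (f ∘ suc) g n) ⟩
    g (suc n) * f 0 + (g ⋆ (f ∘ suc)) n  ≈⟨ +-comm _ _ ⟩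
    (g ⋆ (f ∘ suc)) n + g (suc n) * f 0  ≈⟨ ⋆-sucʳ g f n ⟨
    (g ⋆ f) (suc n)                      ∎
    where open ≈-Reasoning

  ⋆-assoc : ∀ f g h → (f ⋆ g) ⋆ h ≋ f ⋆ (g ⋆ h)
  ⋆-assoc f g h zero    = *-assoc _ _ _
  ⋆-assoc f g h (suc n) = begin
    ((f ⋆ g) ⋆ h) (suc n)
      ≈⟨ ⋆-suc (f ⋆ g) h n ⟩
    (f 0 * g 0) * h (suc n) + (((f ⋆ g) ∘ suc) ⋆ h) n
      ≈⟨ +-cong (*-assoc _ _ _) tail≈ ⟩
    f 0 * (g 0 * h (suc n)) + (f 0 * ((g ∘ suc) ⋆ h) n + ((f ∘ suc) ⋆ (g ⋆ h)) n)
      ≈⟨ +-assoc _ _ _ ⟨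
    (f 0 * (g 0 * h (suc n)) + f 0 * ((g ∘ suc) ⋆ h) n) + ((f ∘ suc) ⋆ (g ⋆ h)) n
      ≈⟨ +-congʳ (trans (sym (distribˡ _ _ _)) (*-congˡ (sym (⋆-suc g h n)))) ⟩
    f 0 * (g ⋆ h) (suc n) + ((f ∘ suc) ⋆ (g ⋆ h)) n
      ≈⟨ ⋆-suc f (g ⋆ h) n ⟨
    (f ⋆ (g ⋆ h)) (suc n)
      ∎
    where
    open ≈-Reasoning
    tail≈ : (((f ⋆ g) ∘ suc) ⋆ h) n ≈ f 0 * ((g ∘ suc) ⋆ h) n + ((f ∘ suc) ⋆ (g ⋆ h)) n
    tail≈ = begin
      (((f ⋆ g) ∘ suc) ⋆ h) n
        ≈⟨ ⋆-congʳ h (⋆-suc f g) n ⟩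
      ((λ i → f 0 * g (suc i) + ((f ∘ suc) ⋆ g) i) ⋆ h) n
        ≈⟨ ⋆-distribʳ (λ i → f 0 * g (suc i)) ((f ∘ suc) ⋆ g) h n ⟩
      ((λ i → f 0 * g (suc i)) ⋆ h) n + (((f ∘ suc) ⋆ g) ⋆ h) n
        ≈⟨ +-cong (⋆-scaleˡ (f 0) (g ∘ suc) h n) (⋆-assoc (f ∘ suc) g h n) ⟩
      f 0 * ((g ∘ suc) ⋆ h) n + ((f ∘ suc) ⋆ (g ⋆ h)) n
        ∎

  ⋆-identityˡ : ∀ f → 𝟙 ⋆ f ≋ f
  ⋆-identityˡ f zero    = *-identityˡ _
  ⋆-identityˡ f (suc n) = trans (⋆-suc 𝟙 f n) (trans (+-cong (*-identityˡ _) tail≈0) (+-identityʳ _))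
    where
    tail≈0 : ((𝟙 ∘ suc) ⋆ f) n ≈ 0#
    tail≈0 = sumUpTo-vanish n (λ i _ → zeroˡ _)

  ⋆-identityʳ : ∀ f → f ⋆ 𝟙 ≋ f
  ⋆-identityʳ f = ≋-trans (⋆-comm f 𝟙) (⋆-identityˡ f)

  ⊞-congˡ : ∀ f {g g′} → g ≋ g′ → f ⊞ g ≋ f ⊞ g′
  ⊞-congˡ f g≋g′ n = +-congˡ (g≋g′ n)

  ⊟-congˡ : ∀ f {g g′} → g ≋ g′ → f ⊟ g ≋ f ⊟ g′
  ⊟-congˡ f g≋g′ n = +-congˡ (-‿cong (g≋g′ n))

  ⊟-⊟ : ∀ f g h → (f ⊟ g) ⊟ h ≋ f ⊟ (g ⊞ h)
  ⊟-⊟ f g h n = trans (+-assoc (f n) (- g n) (- h n)) (+-congˡ (⁻¹-∙-comm (g n) (h n)))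

  fixedPoint⇒inverse : ∀ a f → f ≋ 𝟙 ⊞ a ⋆ f → (𝟙 ⊟ a) ⋆ f ≋ 𝟙
  fixedPoint⇒inverse a f fix n = begin
    ((𝟙 ⊟ a) ⋆ f) n                ≈⟨ ⋆-distribʳ-⊟ 𝟙 a f n ⟩
    (𝟙 ⋆ f) n - (a ⋆ f) n          ≈⟨ +-congʳ (trans (⋆-identityˡ f n) (fix n)) ⟩
    (𝟙 n + (a ⋆ f) n) - (a ⋆ f) n  ≈⟨ x+y-y≈x _ _ ⟩
    𝟙 n                            ∎
    where open ≈-Reasoning

  inverse-unique : ∀ u f g → u ⋆ f ≋ 𝟙 → u ⋆ g ≋ 𝟙 → f ≋ g
  inverse-unique u f g uf≋𝟙 ug≋𝟙 = begin
    f              ≈⟨ ⋆-identityʳ f ⟨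
    f ⋆ 𝟙          ≈⟨ ⋆-congˡ f ug≋𝟙 ⟨
    f ⋆ (u ⋆ g)    ≈⟨ ⋆-assoc f u g ⟨
    (f ⋆ u) ⋆ g    ≈⟨ ⋆-congʳ g (⋆-comm f u) ⟩
    (u ⋆ f) ⋆ g    ≈⟨ ⋆-congʳ g uf≋𝟙 ⟩
    𝟙 ⋆ g          ≈⟨ ⋆-identityˡ g ⟩
    g              ∎
    where open ≋-Reasoning

  halve : PS R → PS R
  halve f n = f (n +ℕ n)

  OddVanishing : PS R → Set ℓ
  OddVanishing f = ∀ n → f (suc (n +ℕ n)) ≈ 0#

  halve-𝟙 : halve 𝟙 ≋ 𝟙
  halve-𝟙 zero    = refl
  halve-𝟙 (suc n) = refl

  halve-⋆ : ∀ f g → OddVanishing f → halve (f ⋆ g) ≋ halve f ⋆ halve g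
  halve-⋆ f g odd zero    = refl
  halve-⋆ f g odd (suc n) = begin
    (f ⋆ g) (suc n +ℕ suc n)
      ≡⟨ ≡.cong (f ⋆ g) 2+n+n ⟩
    (f ⋆ g) (suc (suc (n +ℕ n)))
      ≈⟨ trans (⋆-suc f g _) (+-congˡ (⋆-suc (f ∘ suc) g _)) ⟩
    f 0 * g (suc (suc (n +ℕ n))) + (f 1 * g (suc (n +ℕ n)) + (f₂ ⋆ g) (n +ℕ n))
      ≈⟨ +-congˡ (trans (+-congʳ (trans (*-congʳ (odd 0)) (zeroˡ _))) (+-identityˡ _)) ⟩
    f 0 * g (suc (suc (n +ℕ n))) + (f₂ ⋆ g) (n +ℕ n)
      ≈⟨ +-congˡ (halve-⋆ f₂ g odd₂ n) ⟩
    f 0 * g (suc (suc (n +ℕ n))) + (halve f₂ ⋆ halve g) n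
      ≈⟨ +-cong (*-congˡ (reflexive (≡.cong g (≡.sym 2+n+n))))
                (⋆-congʳ (halve g) (λ i → reflexive (≡.cong f (≡.sym 2+n+n))) n) ⟩
    halve f 0 * halve g (suc n) + ((halve f ∘ suc) ⋆ halve g) n
      ≈⟨ ⋆-suc (halve f) (halve g) n ⟨
    (halve f ⋆ halve g) (suc n)
      ∎
    where
    open ≈-Reasoning
    2+n+n : ∀ {n} → suc n +ℕ suc n ≡ suc (suc (n +ℕ n))
    2+n+n {n} = ≡.cong suc (ℕ.+-suc n n)
    f₂ = f ∘ suc ∘ suc
    odd₂ : OddVanishing f₂
    odd₂ m = trans (reflexive (≡.cong (f ∘ suc) (≡.sym 2+n+n))) (odd (suc m))

module WordSums {c ℓ} (R : CommutativeRing c ℓ) where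

  open CommutativeRing R
  open PowerSeries R

  sumR-++ : ∀ xs ys → sumR R (xs ++ ys) ≈ sumR R xs + sumR R ys
  sumR-++ []       ys = sym (+-identityˡ _)
  sumR-++ (x ∷ xs) ys = trans (+-congˡ (sumR-++ xs ys)) (sym (+-assoc _ _ _))

  sumR-filterᵇ : ∀ {A : Set} (p : A → Bool) (f : A → Carrier) xs →
    sumR R (map f (filterᵇ p xs)) ≈ sumR R (map (λ x → if p x then f x else 0#) xs)
  sumR-filterᵇ p f []       = refl
  sumR-filterᵇ p f (x ∷ xs) with p x
  ... | true  = +-congˡ (sumR-filterᵇ p f xs)
  ... | false = trans (sumR-filterᵇ p f xs) (sym (+-identityˡ _))

  opaque
    sumWords : ℕ → (List Step → Carrier) → Carrier
    sumWords m f = sumR R (map f (words m))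

    sumWords-zero : ∀ f → sumWords 0 f ≈ f []
    sumWords-zero f = +-identityʳ _

    sumWords-suc : ∀ m f → sumWords (suc m) f ≈ sumWords m (f ∘ (U ∷_)) + sumWords m (f ∘ (D ∷_))
    sumWords-suc m f = begin
      sumR R (map f (ws U ++ ws D))                  ≡⟨ ≡.cong (sumR R) (map-++ f (ws U) (ws D)) ⟩
      sumR R (map f (ws U) ++ map f (ws D))          ≈⟨ sumR-++ (map f (ws U)) (map f (ws D)) ⟩
      sumR R (map f (ws U)) + sumR R (map f (ws D))  ≡⟨ ≡.cong₂ (λ x y → sumR R x + sumR R y)
                                                                (≡.sym (map-∘ (words m))) (≡.sym (map-∘ (words m))) ⟩
      sumWords m (f ∘ (U ∷_)) + sumWords m (f ∘ (D ∷_)) ∎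
      where
      open ≈-Reasoning
      ws : Step → List (List Step)
      ws s = map (s ∷_) (words m)

    sumWords-filterᵇ : ∀ m (p : List Step → Bool) f →
      sumR R (map f (filterᵇ p (words m))) ≈ sumWords m (λ w → if p w then f w else 0#)
    sumWords-filterᵇ m p f = sumR-filterᵇ p f (words m)

  sumWords-cong : ∀ m {f g} → (∀ w → length w ≡ m → f w ≈ g w) → sumWords m f ≈ sumWords m g
  sumWords-cong zero    {f} {g} f≈g = trans (sumWords-zero f) (trans (f≈g [] ≡.refl) (sym (sumWords-zero g)))
  sumWords-cong (suc m) {f} {g} f≈g = trans (sumWords-suc m f) (trans
    (+-cong (sumWords-cong m (λ w e → f≈g (U ∷ w) (≡.cong suc e)))
            (sumWords-cong m (λ w e → f≈g (D ∷ w) (≡.cong suc e))))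
    (sym (sumWords-suc m g)))

  sumWords-vanish : ∀ m {f} → (∀ w → length w ≡ m → f w ≈ 0#) → sumWords m f ≈ 0#
  sumWords-vanish zero    {f} f≈0 = trans (sumWords-zero f) (f≈0 [] ≡.refl)
  sumWords-vanish (suc m) {f} f≈0 = trans (sumWords-suc m f) (x≈0∧y≈0⇒x+y≈0
    (sumWords-vanish m (λ w e → f≈0 (U ∷ w) (≡.cong suc e)))
    (sumWords-vanish m (λ w e → f≈0 (D ∷ w) (≡.cong suc e))))

  sumWords-supported : ∀ m t {f} → length t ≡ m → (∀ w → length w ≡ m → w ≢ t → f w ≈ 0#) →
    sumWords m f ≈ f t
  sumWords-supported zero    []      ≡.refl off = sumWords-zero _
  sumWords-supported (suc m) (U ∷ t) ≡.refl off = trans (sumWords-suc m _) (trans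
    (+-cong (sumWords-supported m t ≡.refl (λ w e w≢t → off (U ∷ w) (≡.cong suc e) (w≢t ∘ ∷-injectiveʳ)))
            (sumWords-vanish m (λ w e → off (D ∷ w) (≡.cong suc e) (λ ()))))
    (+-identityʳ _))
  sumWords-supported (suc m) (D ∷ t) ≡.refl off = trans (sumWords-suc m _) (trans
    (+-cong (sumWords-vanish m (λ w e → off (U ∷ w) (≡.cong suc e) (λ ())))
            (sumWords-supported m t ≡.refl (λ w e w≢t → off (D ∷ w) (≡.cong suc e) (w≢t ∘ ∷-injectiveʳ))))
    (+-identityˡ _))

  sumWords-+ : ∀ m f g → sumWords m (λ w → f w + g w) ≈ sumWords m f + sumWords m g
  sumWords-+ zero    f g = trans (sumWords-zero _) (sym (+-cong (sumWords-zero f) (sumWords-zero g)))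
  sumWords-+ (suc m) f g = begin
    sumWords (suc m) (λ w → f w + g w)
      ≈⟨ trans (sumWords-suc m _) (+-cong (sumWords-+ m _ _) (sumWords-+ m _ _)) ⟩
    (Σ m (f ∘ (U ∷_)) + Σ m (g ∘ (U ∷_))) + (Σ m (f ∘ (D ∷_)) + Σ m (g ∘ (D ∷_)))
      ≈⟨ +-interchange _ _ _ _ ⟩
    (Σ m (f ∘ (U ∷_)) + Σ m (f ∘ (D ∷_))) + (Σ m (g ∘ (U ∷_)) + Σ m (g ∘ (D ∷_)))
      ≈⟨ +-cong (sumWords-suc m f) (sumWords-suc m g) ⟨
    sumWords (suc m) f + sumWords (suc m) g
      ∎
    where
    open ≈-Reasoning
    Σ = sumWords

  sumWords-*ˡ : ∀ m x f → sumWords m (λ w → x * f w) ≈ x * sumWords m f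
  sumWords-*ˡ zero    x f = trans (sumWords-zero _) (*-congˡ (sym (sumWords-zero f)))
  sumWords-*ˡ (suc m) x f = begin
    sumWords (suc m) (λ w → x * f w)
      ≈⟨ trans (sumWords-suc m _) (+-cong (sumWords-*ˡ m x _) (sumWords-*ˡ m x _)) ⟩
    x * sumWords m (f ∘ (U ∷_)) + x * sumWords m (f ∘ (D ∷_))
      ≈⟨ trans (sym (distribˡ x _ _)) (*-congˡ (sym (sumWords-suc m f))) ⟩
    x * sumWords (suc m) f
      ∎
    where open ≈-Reasoning

  sumWords-sumUpTo : ∀ m n (F : ℕ → List Step → Carrier) →
    sumWords m (λ w → sumUpTo R n (λ j → F j w)) ≈ sumUpTo R n (λ j → sumWords m (F j))
  sumWords-sumUpTo m zero    F = refl
  sumWords-sumUpTo m (suc n) F = trans (sumWords-+ m _ _) (+-congʳ (sumWords-sumUpTo m n F))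

  sumWords-++ : ∀ a b F → sumWords (a +ℕ b) F ≈ sumWords a (λ u → sumWords b (λ v → F (u ++ v)))
  sumWords-++ zero    b F = sym (sumWords-zero _)
  sumWords-++ (suc a) b F = begin
    sumWords (suc (a +ℕ b)) F
      ≈⟨ sumWords-suc (a +ℕ b) F ⟩
    sumWords (a +ℕ b) (F ∘ (U ∷_)) + sumWords (a +ℕ b) (F ∘ (D ∷_))
      ≈⟨ +-cong (sumWords-++ a b _) (sumWords-++ a b _) ⟩
    sumWords a (λ u → sumWords b (λ v → F (U ∷ u ++ v))) + sumWords a (λ u → sumWords b (λ v → F (D ∷ u ++ v)))
      ≈⟨ sumWords-suc a _ ⟨
    sumWords (suc a) (λ u → sumWords b (λ v → F (u ++ v)))
      ∎
    where open ≈-Reasoning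

  emptyWeight : List Step → Carrier
  emptyWeight []      = 1#
  emptyWeight (_ ∷ _) = 0#

  sumWords-emptyWeight : ∀ m → sumWords m emptyWeight ≈ 𝟙 m
  sumWords-emptyWeight zero    = sumWords-zero emptyWeight
  sumWords-emptyWeight (suc m) = sumWords-vanish (suc m) λ { (_ ∷ _) _ → refl }

  -- sumSplits F w = Σ F p r over the factorisations w = p ++ r with p ≢ []
  sumSplits : (List Step → List Step → Carrier) → List Step → Carrier
  sumSplits F []      = 0#
  sumSplits F (s ∷ w) = F (s ∷ []) w + sumSplits (λ p r → F (s ∷ p) r) w

  sumSplits-vanish : ∀ F w → (∀ s p r → (s ∷ p) ++ r ≡ w → F (s ∷ p) r ≈ 0#) → sumSplits F w ≈ 0#
  sumSplits-vanish F []      off = refl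
  sumSplits-vanish F (s ∷ w) off = x≈0∧y≈0⇒x+y≈0
    (off s [] w ≡.refl) (sumSplits-vanish _ w (λ s′ p r e → off s (s′ ∷ p) r (≡.cong (s ∷_) e)))

  sumSplits-single : ∀ F s₀ p₀ r₀ →
    (∀ s p r → (s ∷ p) ++ r ≡ (s₀ ∷ p₀) ++ r₀ → s ∷ p ≢ s₀ ∷ p₀ → F (s ∷ p) r ≈ 0#) →
    sumSplits F ((s₀ ∷ p₀) ++ r₀) ≈ F (s₀ ∷ p₀) r₀
  sumSplits-single F s₀ []        r₀ off = trans
    (+-congˡ (sumSplits-vanish _ r₀ (λ s p r e → off s₀ (s ∷ p) r (≡.cong (s₀ ∷_) e) (λ ()))))
    (+-identityʳ _)
  sumSplits-single F s₀ (s₁ ∷ p₀) r₀ off = trans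
    (+-cong (off s₀ [] _ ≡.refl (λ ()))
            (sumSplits-single (λ p r → F (s₀ ∷ p) r) s₁ p₀ r₀
              (λ s p r e ne → off s₀ (s ∷ p) r (≡.cong (s₀ ∷_) e) (ne ∘ ∷-injectiveʳ))))
    (+-identityˡ _)

  ⋆-series₁ : ∀ f g n → (f ⋆ g) n ≈ f 0 * g n + (series₁ R f ⋆ g) n
  ⋆-series₁ f g zero    = sym (trans (+-congˡ (zeroˡ _)) (+-identityʳ _))
  ⋆-series₁ f g (suc n) = trans (⋆-suc f g n)
    (+-congˡ (sym (trans (⋆-suc (series₁ R f) g n) (trans (+-congʳ (zeroˡ _)) (+-identityˡ _)))))

  sumWords-sumSplits : ∀ m (a b : List Step → Carrier) →
    sumWords m (sumSplits (λ p r → a p * b r)) ≈ (series₁ R (λ L → sumWords L a) ⋆ (λ L → sumWords L b)) m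
  sumWords-sumSplits zero    a b = trans (sumWords-zero _) (sym (zeroˡ _))
  sumWords-sumSplits (suc m) a b = begin
    sumWords (suc m) (sumSplits (λ p r → a p * b r))
      ≈⟨ trans (sumWords-suc m _) (+-cong (startingWith U) (startingWith D)) ⟩
    (A′ U ⋆ B) m + (A′ D ⋆ B) m
      ≈⟨ ⋆-distribʳ (A′ U) (A′ D) B m ⟨
    ((A′ U ⊞ A′ D) ⋆ B) m
      ≈⟨ ⋆-congʳ B (λ L → sumWords-suc L a) m ⟨
    ((A ∘ suc) ⋆ B) m
      ≈⟨ trans (+-congʳ (zeroˡ _)) (+-identityˡ _) ⟨
    0# * B (suc m) + ((A ∘ suc) ⋆ B) m
      ≈⟨ ⋆-suc (series₁ R A) B m ⟨
    (series₁ R A ⋆ B) (suc m)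
      ∎
    where
    open ≈-Reasoning
    A B : PS R
    A L = sumWords L a
    B L = sumWords L b
    A′ : Step → PS R
    A′ s L = sumWords L (a ∘ (s ∷_))
    startingWith : ∀ s → sumWords m (λ w → a (s ∷ []) * b w + sumSplits (λ p r → a (s ∷ p) * b r) w) ≈ (A′ s ⋆ B) m
    startingWith s = begin
      sumWords m (λ w → a (s ∷ []) * b w + sumSplits (λ p r → a (s ∷ p) * b r) w)
        ≈⟨ sumWords-+ m _ _ ⟩
      sumWords m (λ w → a (s ∷ []) * b w) + sumWords m (sumSplits (λ p r → a (s ∷ p) * b r))
        ≈⟨ +-cong (sumWords-*ˡ m _ b) (sumWords-sumSplits m (a ∘ (s ∷_)) b) ⟩
      a (s ∷ []) * B m + (series₁ R (A′ s) ⋆ B) m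
        ≈⟨ +-congʳ (*-congʳ (sumWords-zero _)) ⟨
      A′ s 0 * B m + (series₁ R (A′ s) ⋆ B) m
        ≈⟨ ⋆-series₁ (A′ s) B m ⟨
      (A′ s ⋆ B) m
        ∎

module Weights {c ℓ} (R : CommutativeRing c ℓ) (α β γ : ℕ → CommutativeRing.Carrier R) where

  open CommutativeRing R
  open PowerSeries R
  open WordSums R

  pyramidWeight : (ℕ → Carrier) → List Step → Carrier
  pyramidWeight a w with pyramids w
  ... | just (n ∷ []) = a n
  ... | _             = 0#

  pyramidSeqWeight : ℕ → List Step → Carrier
  pyramidSeqWeight k w with pyramids w
  ... | just is = if k ≤ᵇ length is then prodR R (map α is) else 0#
  ... | nothing = 0#

  pyramidWeight-at : ∀ a w {n} → pyramids w ≡ just (n ∷ []) → pyramidWeight a w ≡ a n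
  pyramidWeight-at a w e rewrite e = ≡.refl

  pyramidSeqWeight-at : ∀ k w {is} → pyramids w ≡ just is →
    pyramidSeqWeight k w ≡ (if k ≤ᵇ length is then prodR R (map α is) else 0#)
  pyramidSeqWeight-at k w e rewrite e = ≡.refl

  pyramidWeight-vanish : ∀ a w → (∀ n → pyramids w ≢ just (n ∷ [])) → pyramidWeight a w ≈ 0#
  pyramidWeight-vanish a w ¬pyramid with pyramids w
  ... | just (n ∷ [])    = ⊥-elim (¬pyramid n ≡.refl)
  ... | just []          = refl
  ... | just (_ ∷ _ ∷ _) = refl
  ... | nothing          = refl

  pyramidSeries : (ℕ → Carrier) → PS R
  pyramidSeries a L = sumWords L (pyramidWeight a)

  pyramidSeries-odd : ∀ a → OddVanishing (pyramidSeries a)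
  pyramidSeries-odd a n = sumWords-vanish _ λ w len → pyramidWeight-vanish a w λ i e →
    even≢odd i n (≡.trans (≡.sym (pyramids-single-length w e)) len)

  halve-pyramidSeries : ∀ a → halve (pyramidSeries a) ≋ series₁ R a
  halve-pyramidSeries a zero    = sumWords-zero _
  halve-pyramidSeries a (suc n) = trans
    (sumWords-supported _ (pyramid (suc n)) (length-pyramid (suc n)) off)
    (reflexive (pyramidWeight-at a (pyramid (suc n)) (pyramids-pyramid {suc n} (s≤s z≤n))))
    where
    off : ∀ w → length w ≡ suc n +ℕ suc n → w ≢ pyramid (suc n) → pyramidWeight a w ≈ 0#
    off w len w≢ = pyramidWeight-vanish a w λ i e → w≢ (≡.trans (proj₁ (pyramids-single w e))
      (≡.cong pyramid (+-self-injective {i} {suc n} (≡.trans (≡.sym (pyramids-single-length w e)) len))))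

  pyramidSplit-cases : ∀ k p r →
    (Σ[ j ∈ ℕ ] Σ[ js ∈ List ℕ ] pyramids p ≡ just (j ∷ []) × pyramids r ≡ just js) ⊎
    (pyramidWeight α p * pyramidSeqWeight k r ≈ 0#)
  pyramidSplit-cases k p r with pyramids p | pyramids r
  ... | just (j ∷ [])    | just js = inj₁ (j , js , ≡.refl , ≡.refl)
  ... | just (j ∷ [])    | nothing = inj₂ (zeroʳ _)
  ... | just []          | _       = inj₂ (zeroˡ _)
  ... | just (_ ∷ _ ∷ _) | _       = inj₂ (zeroˡ _)
  ... | nothing          | _       = inj₂ (zeroˡ _)

  pyramidSeqWeight-suc : ∀ k w →
    pyramidSeqWeight (suc k) w ≈ sumSplits (λ p r → pyramidWeight α p * pyramidSeqWeight k r) w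
  pyramidSeqWeight-suc k w with pyramids w in e
  ... | nothing = sym (sumSplits-vanish _ w off)
    where
    off : ∀ s p r → (s ∷ p) ++ r ≡ w → pyramidWeight α (s ∷ p) * pyramidSeqWeight k r ≈ 0#
    off s p r w≡ with pyramidSplit-cases k (s ∷ p) r
    ... | inj₂ ≈0 = ≈0
    ... | inj₁ (_ , _ , ep , er)
      with () ← ≡.trans (≡.sym e) (≡.trans (≡.cong pyramids (≡.sym w≡)) (pyramids-cons (s ∷ p) r ep er))
  ... | just [] with pyramids-sound w e
  ...   | ≡.refl , _ = refl
  pyramidSeqWeight-suc k w | just (i ∷ is) with pyramids-sound w e
  ... | ≡.refl , (s≤s {n = i′} z≤n ∷ hs) = sym (begin
    sumSplits F (pyramid i ++ pyramidSeq is)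
      ≈⟨ sumSplits-single F U (ups i′ ++ downs i) (pyramidSeq is) off ⟩
    pyramidWeight α (pyramid i) * pyramidSeqWeight k (pyramidSeq is)
      ≡⟨ ≡.cong₂ _*_ (pyramidWeight-at α (pyramid i) (pyramids-pyramid {i} (s≤s z≤n)))
                     (pyramidSeqWeight-at k (pyramidSeq is) (pyramids-pyramidSeq is hs)) ⟩
    α i * (if k ≤ᵇ length is then prodR R (map α is) else 0#)
      ≈⟨ *-if (k ≤ᵇ length is) ⟩
    (if k ≤ᵇ length is then α i * prodR R (map α is) else 0#)
      ≡⟨ ≡.cong (λ b → if b then α i * prodR R (map α is) else 0#) (≤ᵇ-suc k (length is)) ⟨
    (if suc k ≤ᵇ suc (length is) then α i * prodR R (map α is) else 0#)
      ∎)
    where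
    open ≈-Reasoning
    F = λ p r → pyramidWeight α p * pyramidSeqWeight k r
    *-if : ∀ b {x y} → x * (if b then y else 0#) ≈ (if b then x * y else 0#)
    *-if true  = refl
    *-if false = zeroʳ _
    off : ∀ s p r → (s ∷ p) ++ r ≡ pyramid i ++ pyramidSeq is → s ∷ p ≢ pyramid i → F (s ∷ p) r ≈ 0#
    off s p r w≡ ≢pyramid with pyramidSplit-cases k (s ∷ p) r
    ... | inj₂ ≈0 = ≈0
    ... | inj₁ (j , js , ep , er)
      with ≡.trans (≡.sym (pyramids-cons (s ∷ p) r ep er)) (≡.trans (≡.cong pyramids w≡) e)
    ...   | ≡.refl = ⊥-elim (≢pyramid (proj₁ (pyramids-single (s ∷ p) ep)))

  pyramidSeqWeight-zero : ∀ w → pyramidSeqWeight 0 w ≈ emptyWeight w + pyramidSeqWeight 1 w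
  pyramidSeqWeight-zero []      = sym (+-identityʳ _)
  pyramidSeqWeight-zero (s ∷ w) with pyramids (s ∷ w) in e
  ... | just []      with () ← proj₁ (pyramids-sound (s ∷ w) e)
  ... | just (_ ∷ _) = sym (+-identityˡ _)
  ... | nothing      = sym (+-identityˡ _)

  pyramidSeqSeries : ℕ → PS R
  pyramidSeqSeries k L = sumWords L (pyramidSeqWeight k)

  pyramidSeqSeries-suc : ∀ k → pyramidSeqSeries (suc k) ≋ pyramidSeries α ⋆ pyramidSeqSeries k
  pyramidSeqSeries-suc k L = begin
    sumWords L (pyramidSeqWeight (suc k))
      ≈⟨ sumWords-cong L (λ w _ → pyramidSeqWeight-suc k w) ⟩
    sumWords L (sumSplits (λ p r → pyramidWeight α p * pyramidSeqWeight k r))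
      ≈⟨ sumWords-sumSplits L (pyramidWeight α) (pyramidSeqWeight k) ⟩
    (series₁ R (pyramidSeries α) ⋆ pyramidSeqSeries k) L
      ≈⟨ ⋆-congʳ (pyramidSeqSeries k) series₁-pyramidSeries L ⟩
    (pyramidSeries α ⋆ pyramidSeqSeries k) L
      ∎
    where
    open ≈-Reasoning
    series₁-pyramidSeries : series₁ R (pyramidSeries α) ≋ pyramidSeries α
    series₁-pyramidSeries zero    = sym (sumWords-zero _)
    series₁-pyramidSeries (suc L) = refl

  halve-pyramidSeqSeries-suc : ∀ k → halve (pyramidSeqSeries (suc k)) ≋ series₁ R α ⋆ halve (pyramidSeqSeries k)
  halve-pyramidSeqSeries-suc k n = begin
    pyramidSeqSeries (suc k) (n +ℕ n)
      ≈⟨ pyramidSeqSeries-suc k (n +ℕ n) ⟩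
    halve (pyramidSeries α ⋆ pyramidSeqSeries k) n
      ≈⟨ halve-⋆ (pyramidSeries α) (pyramidSeqSeries k) (pyramidSeries-odd α) n ⟩
    (halve (pyramidSeries α) ⋆ halve (pyramidSeqSeries k)) n
      ≈⟨ ⋆-congʳ (halve (pyramidSeqSeries k)) (halve-pyramidSeries α) n ⟩
    (series₁ R α ⋆ halve (pyramidSeqSeries k)) n
      ∎
    where open ≈-Reasoning

  halve-pyramidSeqSeries-zero : halve (pyramidSeqSeries 0) ≋ 𝟙 ⊞ series₁ R α ⋆ halve (pyramidSeqSeries 0)
  halve-pyramidSeqSeries-zero n = begin
    sumWords (n +ℕ n) (pyramidSeqWeight 0)
      ≈⟨ sumWords-cong _ (λ w _ → pyramidSeqWeight-zero w) ⟩
    sumWords (n +ℕ n) (λ w → emptyWeight w + pyramidSeqWeight 1 w)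
      ≈⟨ sumWords-+ _ _ _ ⟩
    sumWords (n +ℕ n) emptyWeight + halve (pyramidSeqSeries 1) n
      ≈⟨ +-cong (trans (sumWords-emptyWeight _) (halve-𝟙 n)) (halve-pyramidSeqSeries-suc 0 n) ⟩
    𝟙 n + (series₁ R α ⋆ halve (pyramidSeqSeries 0)) n
      ∎
    where open ≈-Reasoning

  halve-pyramidSeqSeries-2 : ∀ h → (𝟙 ⊟ series₁ R α) ⋆ h ≋ 𝟙 →
    halve (pyramidSeqSeries 2) ≋ (series₁ R α ⋆ series₁ R α) ⋆ h
  halve-pyramidSeqSeries-2 h h-inverse = begin
    halve (pyramidSeqSeries 2)      ≈⟨ halve-pyramidSeqSeries-suc 1 ⟩
    A ⋆ halve (pyramidSeqSeries 1)  ≈⟨ ⋆-congˡ A (halve-pyramidSeqSeries-suc 0) ⟩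
    A ⋆ (A ⋆ Y₀)                    ≈⟨ ⋆-congˡ A (⋆-congˡ A Y₀≋h) ⟩
    A ⋆ (A ⋆ h)                     ≈⟨ ⋆-assoc A A h ⟨
    (A ⋆ A) ⋆ h                     ∎
    where
    open ≋-Reasoning
    A = series₁ R α
    Y₀ = halve (pyramidSeqSeries 0)
    Y₀≋h : Y₀ ≋ h
    Y₀≋h = inverse-unique (𝟙 ⊟ A) Y₀ h (fixedPoint⇒inverse A Y₀ halve-pyramidSeqSeries-zero) h-inverse

  framedWeight : ℕ → List Step → Carrier
  framedWeight zero    w = 0#
  framedWeight (suc k) w with middle (suc k) w
  ... | just m  = β (suc k) * pyramidSeqWeight 2 m
  ... | nothing = 0#

  framedWeight-unframed : ∀ k w → ¬ Framed k w → framedWeight k w ≈ 0#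
  framedWeight-unframed zero    w ¬F = refl
  framedWeight-unframed (suc k) w ¬F with middle (suc k) w in e₁
  ... | nothing = refl
  ... | just m with pyramids m in e₂
  ...   | just (_ ∷ _ ∷ _) = ⊥-elim (¬F (framed e₁ e₂))
  ...   | just []          = zeroʳ _
  ...   | just (_ ∷ [])    = zeroʳ _
  ...   | nothing          = zeroʳ _

  framedWeight-frame : ∀ k m →
    framedWeight (suc k) (ups (suc k) ++ m ++ downs (suc k)) ≡ β (suc k) * pyramidSeqWeight 2 m
  framedWeight-frame k m rewrite middle-frame (suc k) m = ≡.refl

  sumWords-framedWeight : ∀ k M →
    sumWords (suc k +ℕ (M +ℕ suc k)) (framedWeight (suc k)) ≈ β (suc k) * pyramidSeqSeries 2 M
  sumWords-framedWeight k M = begin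
    sumWords (K +ℕ (M +ℕ K)) (framedWeight K)
      ≈⟨ sumWords-++ K (M +ℕ K) _ ⟩
    sumWords K (λ a → sumWords (M +ℕ K) (λ v → framedWeight K (a ++ v)))
      ≈⟨ sumWords-cong K (λ a _ → sumWords-++ M K _) ⟩
    sumWords K (λ a → sumWords M (λ m → sumWords K (λ b → framedWeight K (a ++ m ++ b))))
      ≈⟨ sumWords-cong K (λ a la → sumWords-cong M (λ m _ →
           sumWords-supported K (downs K) (length-replicate K) (λ b lb b≢ → outside-frame a m b la lb (inj₂ b≢)))) ⟩
    sumWords K (λ a → sumWords M (λ m → framedWeight K (a ++ m ++ downs K)))
      ≈⟨ sumWords-supported K (ups K) (length-replicate K) (λ a la a≢ → sumWords-vanish M λ m _ →
           outside-frame a m (downs K) la (length-replicate K) (inj₁ a≢)) ⟩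
    sumWords M (λ m → framedWeight K (ups K ++ m ++ downs K))
      ≈⟨ sumWords-cong M (λ m _ → reflexive (framedWeight-frame k m)) ⟩
    sumWords M (λ m → β K * pyramidSeqWeight 2 m)
      ≈⟨ sumWords-*ˡ M (β K) _ ⟩
    β K * pyramidSeqSeries 2 M
      ∎
    where
    open ≈-Reasoning
    K = suc k
    outside-frame : ∀ a m b → length a ≡ K → length b ≡ K → a ≢ ups K ⊎ b ≢ downs K →
      framedWeight K (a ++ m ++ b) ≈ 0#
    outside-frame a m b la lb ≢frame with middle K (a ++ m ++ b) in e
    ... | nothing = refl
    ... | just _ with middle-frame-unique K a m b la lb e | ≢frame
    ...   | a≡ , _ | inj₁ a≢ = ⊥-elim (a≢ a≡)
    ...   | _ , b≡ | inj₂ b≢ = ⊥-elim (b≢ b≡)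

  framedSum : ℕ → List Step → Carrier
  framedSum n w = sumUpTo R n (λ k → framedWeight k w)

  framedSum-vanish : ∀ n w → (∀ k → ¬ Framed (suc k) w) → framedSum n w ≈ 0#
  framedSum-vanish n w ¬F = sumUpTo-vanish n λ where
    zero    _ → refl
    (suc k) _ → framedWeight-unframed (suc k) w (¬F k)

  framedSum-single : ∀ n w {k} → length w ≡ n +ℕ n → Framed (suc k) w → framedSum n w ≈ framedWeight (suc k) w
  framedSum-single n w len F =
    sumUpTo-single n _ (+-self-cancel-≤ (ℕ.≤-trans (Framed-length F) (ℕ.≤-reflexive len))) λ where
      zero    _   → refl
      (suc j) j≢k → framedWeight-unframed (suc j) w (λ F′ → j≢k (Framed-unique F′ F))

  sumWords-framedSum : ∀ n → sumWords (n +ℕ n) (framedSum n) ≈ (series₁ R β ⋆ halve (pyramidSeqSeries 2)) n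
  sumWords-framedSum n = trans (sumWords-sumUpTo (n +ℕ n) n framedWeight) (sumUpTo-cong n level)
    where
    split : ∀ {k} → suc k ≤ n → n +ℕ n ≡ suc k +ℕ ((n ∸ suc k +ℕ (n ∸ suc k)) +ℕ suc k)
    split {k} le = ≡.trans (≡.cong (λ m → m +ℕ m) (≡.sym (ℕ.m+[n∸m]≡n le))) (rearrange (suc k) (n ∸ suc k))
      where
      rearrange : ∀ k d → (k +ℕ d) +ℕ (k +ℕ d) ≡ k +ℕ ((d +ℕ d) +ℕ k)
      rearrange = solve-∀
    level : ∀ k → k ≤ n → sumWords (n +ℕ n) (framedWeight k) ≈ series₁ R β k * halve (pyramidSeqSeries 2) (n ∸ k)
    level zero    _  = trans (sumWords-vanish _ (λ _ _ → refl)) (sym (zeroˡ _))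
    level (suc k) le = trans (reflexive (≡.cong (λ L → sumWords L (framedWeight (suc k))) (split le)))
                             (sumWords-framedWeight k _)

  private
    []≢∷ : ∀ {A : Set} {x : A} {xs : List A} → List.[] ≢ x List.∷ xs
    []≢∷ ()

  allB-replicate : ∀ n x → allB (λ l → l ≡ᵇ x) (replicate n x) ≡ true
  allB-replicate zero    x = ≡.refl
  allB-replicate (suc n) x rewrite ≡ᵇ-refl x = allB-replicate n x

  weightA-noValley : ∀ w → valleyLevels w ≡ [] → weightA R α β γ w ≡ pyramidWeight γ w
  weightA-noValley w v rewrite v with pyramids w
  ... | just (_ ∷ [])    = ≡.refl
  ... | just []          = ≡.refl
  ... | just (_ ∷ _ ∷ _) = ≡.refl
  ... | nothing          = ≡.refl

  weightA-framed : ∀ {k w} → Framed (suc k) w → weightA R α β γ w ≡ framedWeight (suc k) w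
  weightA-framed {k} F@(framed {is = is} middle≡ pyramids≡)
    rewrite Framed-valleys F | allB-replicate (length is) (suc k) | middle≡ | pyramids≡ = ≡.refl

  weightA-unframed : ∀ w → valleyLevels w ≢ [] → (∀ k → ¬ Framed (suc k) w) → weightA R α β γ w ≡ 0#
  weightA-unframed w hasValley ¬F with valleyLevels w
  ... | []        = ⊥-elim (hasValley ≡.refl)
  ... | zero  ∷ _ = ≡.refl
  ... | suc k ∷ ls with allB (λ l → l ≡ᵇ suc k) ls | middle (suc k) w in e₁
  ...   | false | _       = ≡.refl
  ...   | true  | nothing = ≡.refl
  ...   | true  | just m with pyramids m in e₂
  ...     | just (_ ∷ _ ∷ _) = ⊥-elim (¬F k (framed e₁ e₂))
  ...     | just []          = ≡.refl
  ...     | just (_ ∷ [])    = ≡.refl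
  ...     | nothing          = ≡.refl

  weightA-split : ∀ n w → length w ≡ n +ℕ n → weightA R α β γ w ≈ pyramidWeight γ w + framedSum n w
  weightA-split n w len = byValleys (valleyLevels w) ≡.refl
    where
    open ≈-Reasoning
    pyramid-vanish : ∀ {l ls} → valleyLevels w ≡ l ∷ ls → pyramidWeight γ w ≈ 0#
    pyramid-vanish v = pyramidWeight-vanish γ w λ i e → []≢∷ (≡.trans (≡.sym (valleyLevels-pyramid i))
      (≡.trans (≡.cong valleyLevels (≡.sym (proj₁ (pyramids-single w e)))) v))
    unframed : ∀ {l ls} → valleyLevels w ≡ l ∷ ls → (∀ k → ¬ Framed (suc k) w) →
      weightA R α β γ w ≈ pyramidWeight γ w + framedSum n w
    unframed v ¬F = begin
      weightA R α β γ w                  ≡⟨ weightA-unframed w (λ e → []≢∷ (≡.trans (≡.sym e) v)) ¬F ⟩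
      0#                                 ≈⟨ +-identityʳ 0# ⟨
      0# + 0#                            ≈⟨ +-cong (pyramid-vanish v) (framedSum-vanish n w ¬F) ⟨
      pyramidWeight γ w + framedSum n w  ∎
    byValleys : ∀ vs → valleyLevels w ≡ vs → weightA R α β γ w ≈ pyramidWeight γ w + framedSum n w
    byValleys [] v = begin
      weightA R α β γ w                  ≡⟨ weightA-noValley w v ⟩
      pyramidWeight γ w                  ≈⟨ +-identityʳ _ ⟨
      pyramidWeight γ w + 0#             ≈⟨ +-congˡ (framedSum-vanish n w λ k F →
                                                       []≢∷ (≡.trans (≡.sym v) (Framed-valleys F))) ⟨
      pyramidWeight γ w + framedSum n w  ∎
    byValleys (zero ∷ _) v = unframed v λ k F → ℕ.0≢1+n (Framed-head F v)
    byValleys (suc k ∷ _) v with framed? (suc k) w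
    ... | no ¬F = unframed v λ k′ F′ → ¬F (≡.subst (λ l → Framed l w) (≡.sym (Framed-head F′ v)) F′)
    ... | yes F = begin
      weightA R α β γ w                  ≡⟨ weightA-framed F ⟩
      framedWeight (suc k) w             ≈⟨ +-identityˡ _ ⟨
      0# + framedWeight (suc k) w        ≈⟨ +-cong (pyramid-vanish v) (framedSum-single n w len F) ⟨
      pyramidWeight γ w + framedSum n w  ∎

  primitiveWeight : List Step → Carrier
  primitiveWeight p = if isPrimitive p then weightA R α β γ p else 0#

  primitiveWeight-split : ∀ n w → length w ≡ n +ℕ n → primitiveWeight w ≈ pyramidWeight γ w + framedSum n w
  primitiveWeight-split n w len with isPrimitive w in prim
  ... | true  = weightA-split n w len
  ... | false = sym (x≈0∧y≈0⇒x+y≈0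
    (pyramidWeight-vanish γ w λ i e → true≢false (≡.trans (≡.sym (pyramid-primitive e)) prim))
    (framedSum-vanish n w λ k F → true≢false (≡.trans (≡.sym (Framed-primitive F)) prim)))
    where
    true≢false : true ≢ false
    true≢false ()
    pyramid-primitive : ∀ {i} → pyramids w ≡ just (i ∷ []) → isPrimitive w ≡ true
    pyramid-primitive e with pyramids-single w e
    ... | w≡ , 0<i = ≡.trans (≡.cong isPrimitive w≡) (isPrimitive-pyramid 0<i)

  primitiveSeries : PS R
  primitiveSeries = series₁ R (λ L → sumWords L primitiveWeight)

  primitiveSeries-odd : OddVanishing primitiveSeries
  primitiveSeries-odd n = sumWords-vanish _ λ w len → oddLength w len
    where
    oddLength : ∀ w → length w ≡ suc (n +ℕ n) → primitiveWeight w ≈ 0#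
    oddLength w len with isPrimitive w in prim
    ... | false = refl
    ... | true with () ← ≡.trans (≡.sym (primitiveFrom-parity 0 w prim)) (≡.trans (≡.cong parity len) (parity-odd n))

  halve-primitiveSeries : halve primitiveSeries ≋ series₁ R γ ⊞ series₁ R β ⋆ halve (pyramidSeqSeries 2)
  halve-primitiveSeries zero    = sym (trans (+-identityˡ _) (zeroˡ _))
  halve-primitiveSeries (suc n) = begin
    sumWords (m +ℕ m) primitiveWeight
      ≈⟨ sumWords-cong _ (primitiveWeight-split m) ⟩
    sumWords (m +ℕ m) (λ w → pyramidWeight γ w + framedSum m w)
      ≈⟨ sumWords-+ _ _ _ ⟩
    sumWords (m +ℕ m) (pyramidWeight γ) + sumWords (m +ℕ m) (framedSum m)
      ≈⟨ +-cong (halve-pyramidSeries γ m) (sumWords-framedSum m) ⟩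
    series₁ R γ m + (series₁ R β ⋆ halve (pyramidSeqSeries 2)) m
      ∎
    where
    open ≈-Reasoning
    m = suc n

  dyckWeight : List Step → Carrier
  dyckWeight w = if isDyck w then weightV R α β γ w else 0#

  weightV-primitive : ∀ p r → isPrimitive p ≡ true → isDyck r ≡ true →
    weightV R α β γ (p ++ r) ≡ primitiveWeight p * dyckWeight r
  weightV-primitive p r prim dyck rewrite primComponents-primitive p r prim | prim | dyck = ≡.refl

  primitiveSplit-cases : ∀ p r → (isPrimitive p ≡ true × isDyck r ≡ true) ⊎ (primitiveWeight p * dyckWeight r ≈ 0#)
  primitiveSplit-cases p r with isPrimitive p | isDyck r
  ... | true  | true  = inj₁ (≡.refl , ≡.refl)
  ... | true  | false = inj₂ (zeroʳ _)
  ... | false | _     = inj₂ (zeroˡ _)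

  dyckWeight-firstReturn : ∀ w →
    dyckWeight w ≈ emptyWeight w + sumSplits (λ p r → primitiveWeight p * dyckWeight r) w
  dyckWeight-firstReturn []      = sym (+-identityʳ _)
  dyckWeight-firstReturn (s ∷ w) with isDyck (s ∷ w) in dyck
  ... | false = sym (trans (+-identityˡ _) (sumSplits-vanish (λ p r → primitiveWeight p * dyckWeight r) _ off))
    where
    off : ∀ s′ p r → (s′ ∷ p) ++ r ≡ s ∷ w → primitiveWeight (s′ ∷ p) * dyckWeight r ≈ 0#
    off s′ p r w≡ with primitiveSplit-cases (s′ ∷ p) r
    ... | inj₂ ≈0          = ≈0
    ... | inj₁ (prim , d)
      with () ← ≡.trans (≡.sym (primitiveFrom-++-dyck 0 (s′ ∷ p) r prim d)) (≡.trans (≡.cong isDyck w≡) dyck)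
  dyckWeight-firstReturn (D ∷ w) | true with () ← dyck
  dyckWeight-firstReturn (U ∷ w) | true with dyckFrom-firstReturn 0 w dyck
  ... | p , r , ≡.refl , prim , d = begin
    weightV R α β γ (U ∷ p ++ r)            ≡⟨ weightV-primitive (U ∷ p) r prim d ⟩
    primitiveWeight (U ∷ p) * dyckWeight r  ≈⟨ sumSplits-single F U p r off ⟨
    sumSplits F (U ∷ p ++ r)                ≈⟨ +-identityˡ _ ⟨
    0# + sumSplits F (U ∷ p ++ r)           ∎
    where
    open ≈-Reasoning
    F = λ p r → primitiveWeight p * dyckWeight r
    off : ∀ s′ p′ r′ → (s′ ∷ p′) ++ r′ ≡ (U ∷ p) ++ r → s′ ∷ p′ ≢ U ∷ p → F (s′ ∷ p′) r′ ≈ 0#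
    off s′ p′ r′ w≡ ≢p with primitiveSplit-cases (s′ ∷ p′) r′
    ... | inj₂ ≈0          = ≈0
    ... | inj₁ (prim′ , _) = ⊥-elim (≢p (primitiveFrom-prefix-unique 0 (s′ ∷ p′) r′ (U ∷ p) r w≡ prim′ prim))

  dyckSeries : PS R
  dyckSeries L = sumWords L dyckWeight

  dyckSeries-fixedPoint : dyckSeries ≋ 𝟙 ⊞ primitiveSeries ⋆ dyckSeries
  dyckSeries-fixedPoint L = begin
    sumWords L dyckWeight
      ≈⟨ sumWords-cong L (λ w _ → dyckWeight-firstReturn w) ⟩
    sumWords L (λ w → emptyWeight w + sumSplits F w)
      ≈⟨ sumWords-+ L _ _ ⟩
    sumWords L emptyWeight + sumWords L (sumSplits F)
      ≈⟨ +-cong (sumWords-emptyWeight L) (sumWords-sumSplits L primitiveWeight dyckWeight) ⟩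
    𝟙 L + (primitiveSeries ⋆ dyckSeries) L
      ∎
    where
    open ≈-Reasoning
    F = λ p r → primitiveWeight p * dyckWeight r

  V-fixedPoint : V R α β γ ≋ 𝟙 ⊞ halve primitiveSeries ⋆ V R α β γ
  V-fixedPoint n = begin
    V R α β γ n
      ≈⟨ V≋halve n ⟩
    dyckSeries (n +ℕ n)
      ≈⟨ dyckSeries-fixedPoint (n +ℕ n) ⟩
    𝟙 (n +ℕ n) + (primitiveSeries ⋆ dyckSeries) (n +ℕ n)
      ≈⟨ +-cong (halve-𝟙 n) (halve-⋆ primitiveSeries dyckSeries primitiveSeries-odd n) ⟩
    𝟙 n + (halve primitiveSeries ⋆ halve dyckSeries) n
      ≈⟨ +-congˡ (⋆-congˡ (halve primitiveSeries) (λ m → sym (V≋halve m)) n) ⟩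
    𝟙 n + (halve primitiveSeries ⋆ V R α β γ) n
      ∎
    where
    open ≈-Reasoning
    V≋halve : V R α β γ ≋ halve dyckSeries
    V≋halve m = sumWords-filterᵇ (m +ℕ m) isDyck (weightV R α β γ)

theorem2p1 : ∀ {c ℓ} (R : CommutativeRing c ℓ) (α β γ : ℕ → CommutativeRing.Carrier R)
             (h : PS R) →
             _≈S_ R (_⊛_ R (_⊖_ R (oneS R) (series₁ R α)) h) (oneS R) →
             _≈S_ R
               (_⊛_ R (V R α β γ)
                 (_⊖_ R (_⊖_ R (oneS R) (series₁ R γ))
                   (_⊛_ R (_⊛_ R (_⊛_ R (series₁ R α) (series₁ R α)) (series₁ R β)) h)))
               (oneS R)
theorem2p1 R α β γ h h-inverse = begin
  V R α β γ ⋆ ((𝟙 ⊟ Γ) ⊟ X)  ≈⟨ ⋆-congˡ (V R α β γ) (≋-trans (⊟-⊟ 𝟙 Γ X) (⊟-congˡ 𝟙 (≋-sym P≋Γ+X))) ⟩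
  V R α β γ ⋆ (𝟙 ⊟ P)        ≈⟨ ⋆-comm (V R α β γ) (𝟙 ⊟ P) ⟩
  (𝟙 ⊟ P) ⋆ V R α β γ        ≈⟨ fixedPoint⇒inverse P (V R α β γ) V-fixedPoint ⟩
  𝟙                          ∎
  where
  open PowerSeries R
  open Weights R α β γ
  open ≋-Reasoning
  A = series₁ R α
  B = series₁ R β
  Γ = series₁ R γ
  X = ((A ⋆ A) ⋆ B) ⋆ h
  P = halve primitiveSeries
  P≋Γ+X : P ≋ Γ ⊞ X
  P≋Γ+X = begin
    P                                   ≈⟨ halve-primitiveSeries ⟩
    Γ ⊞ B ⋆ halve (pyramidSeqSeries 2)  ≈⟨ ⊞-congˡ Γ (⋆-congˡ B (halve-pyramidSeqSeries-2 h h-inverse)) ⟩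
    Γ ⊞ B ⋆ ((A ⋆ A) ⋆ h)               ≈⟨ ⊞-congˡ Γ (⋆-assoc B (A ⋆ A) h) ⟨
    Γ ⊞ (B ⋆ (A ⋆ A)) ⋆ h               ≈⟨ ⊞-congˡ Γ (⋆-congʳ h (⋆-comm B (A ⋆ A))) ⟩
    Γ ⊞ X                               ∎
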